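{- For integers $a,b\ge0$, $$\sum_{c=0}^{\min(a,b)}(\lambda;\lambda^2)_c\binom{a+b}{2c,\,a-c,\,b-c}_{\lambda}\lambda^{(a-c)(b-c)+c}=\binom{a+b}{a}_{\lambda^2}\frac{\lambda^a+\lambda^b}{\lambda^{a+b}+1}.$$
   Context: $(x;y)_n=\prod_{i=1}^n(1-xy^{i-1})$, $(x)_n=\prod_{i=1}^n(x^i-1)$. The $\lambda$-multinomial is $\binom{n}{m_1,\dots,m_r}_\lambda=\frac{(n)_\lambda}{(m_1)_\lambda\cdots(m_r)_\lambda}$ when $n=m_1+\dots+m_r$ and all $m_i\ge0$, and $0$ otherwise; $\binom{n}{m}_\lambda=\binom{n}{m,n-m}_\lambda$. The identity is in $\mathbb{Z}(\lambda)$. -}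

module Defs where

open import Data.Nat as ℕ using (ℕ; zero; suc; _∸_; _≟_)
open import Data.Integer as ℤ using (ℤ; +_; -_)
open import Data.List using (List; []; _∷_; map; foldr)
open import Data.List.Relation.Unary.All using (All)
open import Relation.Binary.PropositionalEquality using (_≡_)
open import Relation.Nullary using (yes; no)

-- Polynomials in one variable λ over ℤ, as coefficient lists
-- (lowest degree first).  Equality ignores trailing zeros.

Poly : Set
Poly = List ℤ

_+ₚ_ : Poly → Poly → Poly
[]      +ₚ q       = q
(a ∷ p) +ₚ []      = a ∷ p
(a ∷ p) +ₚ (b ∷ q) = (a ℤ.+ b) ∷ (p +ₚ q)

_·ₚ_ : ℤ → Poly → Poly
a ·ₚ p = map (a ℤ.*_) p

_*ₚ_ : Poly → Poly → Poly
[]      *ₚ q = []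
(a ∷ p) *ₚ q = (a ·ₚ q) +ₚ (+ 0 ∷ (p *ₚ q))

negₚ : Poly → Poly
negₚ = map (-_)

IsZeroₚ : Poly → Set
IsZeroₚ p = All (_≡ + 0) p

_≈ₚ_ : Poly → Poly → Set
p ≈ₚ q = IsZeroₚ (p +ₚ negₚ q)

-- The field ℤ(λ) of rational functions, as formal fractions num/den,
-- with the usual equality  a/b ≈ c/d  ⇔  a·d = c·b  in ℤ[λ].

record RatFun : Set where
  constructor _/_
  field
    num : Poly
    den : Poly
open RatFun public

_≈_ : RatFun → RatFun → Set
x ≈ y = (num x *ₚ den y) ≈ₚ (num y *ₚ den x)

infix 4 _≈_
infixl 6 _+_ _-_
infixl 7 _*_ _÷_

_+_ : RatFun → RatFun → RatFun
x + y = ((num x *ₚ den y) +ₚ (num y *ₚ den x)) / (den x *ₚ den y)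

neg : RatFun → RatFun
neg x = negₚ (num x) / den x

_-_ : RatFun → RatFun → RatFun
x - y = x + neg y

_*_ : RatFun → RatFun → RatFun
x * y = (num x *ₚ num y) / (den x *ₚ den y)

-- division (only meaningful for nonzero divisor; all divisors used below
-- are nonzero rational functions)
_÷_ : RatFun → RatFun → RatFun
x ÷ y = (num x *ₚ den y) / (den x *ₚ num y)

const : ℤ → RatFun
const a = (a ∷ []) / (+ 1 ∷ [])

𝟘 𝟙 : RatFun
𝟘 = const (+ 0)
𝟙 = const (+ 1)

λ̂ : RatFun
λ̂ = (+ 0 ∷ + 1 ∷ []) / (+ 1 ∷ [])

_^_ : RatFun → ℕ → RatFun
x ^ zero  = 𝟙
x ^ suc n = x * (x ^ n)

prod : ℕ → (ℕ → RatFun) → RatFun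
prod zero    f = 𝟙
prod (suc n) f = prod n f * f (suc n)

sumTo : ℕ → (ℕ → RatFun) → RatFun
sumTo zero    f = f 0
sumTo (suc n) f = sumTo n f + f (suc n)

-- (x;y)_n = ∏_{i=1}^n (1 - x y^{i-1})
poch : RatFun → RatFun → ℕ → RatFun
poch x y n = prod n (λ i → 𝟙 - x * (y ^ (i ∸ 1)))

fac : RatFun → ℕ → RatFun
fac x n = prod n (λ i → (x ^ i) - 𝟙)

multinom3 : RatFun → ℕ → ℕ → ℕ → ℕ → RatFun
multinom3 l n m₁ m₂ m₃ with n ≟ (m₁ ℕ.+ m₂ ℕ.+ m₃)
... | yes _ = fac l n ÷ (fac l m₁ * fac l m₂ * fac l m₃)
... | no  _ = 𝟘

multinom2 : RatFun → ℕ → ℕ → ℕ → RatFun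
multinom2 l n m₁ m₂ with n ≟ (m₁ ℕ.+ m₂)
... | yes _ = fac l n ÷ (fac l m₁ * fac l m₂)
... | no  _ = 𝟘

binom : RatFun → ℕ → ℕ → RatFun
binom l n m with m ℕ.≤? n
... | yes _ = multinom2 l n m (n ∸ m)
... | no  _ = 𝟘

-- Write [n]! = ∏_{i=1}^{n} (λ^i − 1), and [n]!₂ for the same product in λ². Both sides of the
-- identity, as functions f(a, b), equal 1 when a = 0 or b = 0 and satisfy
--   f(a+1, b+1) = f(a, b+1) + f(a+1, b) + (1 + λ^{a+b}) (λ^{a+b+1} − 1) f(a, b),
-- so they agree. For the right side, [a+b]!₂ (λ^a + λ^b) / ([a]!₂ [b]!₂ (λ^{a+b} + 1)), this is a
-- polynomial identity once denominators are cleared. The left side is [a+b]! G(a, b) with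
-- G(a, b) = Σ_c A_c B_{a−c, b−c}, A_c = (λ; λ²)_c λ^c / [2c]! and B_{m,n} = λ^{mn} / ([m]! [n]!),
-- and the recurrence becomes
--   (λ^{a+b+2} − 1) G(a+1, b+1) = G(a, b+1) + G(a+1, b) + (1 + λ^{a+b}) G(a, b).
-- As λ^{a+b} G(a, b) = Σ_c (λ^{2c} A_c) (λ^{m+n} B_{m,n}) with m = a − c and n = b − c, this follows
-- by comparing the weighted sums at (a+1, b+1) and at (a, b), using λ^{2c} A_c = A_c − λ A_{c−1}
-- and a four-term relation satisfied by λ^{m+n} B_{m,n}.

module Submission where

open import Algebra.Bundles using (CommutativeRing)

module Polynomial where

  open import Defs using (Poly; _+ₚ_; _·ₚ_; _*ₚ_; negₚ; IsZeroₚ; _≈ₚ_)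
  open import Data.Nat using (ℕ; zero; suc)
  open import Data.Integer using (ℤ; +_; -_) renaming (_+_ to _+ℤ_; _*_ to _*ℤ_)
  import Data.Integer.Properties as ℤP
  open import Data.List using ([]; _∷_)
  open import Data.List.Relation.Unary.All using ([]; _∷_)
  open import Data.Maybe using (Maybe; just; nothing)
  open import Data.Sum using (inj₁; inj₂)
  open import Relation.Nullary using (¬_; yes; no; contradiction)
  open import Tactic.RingSolver using (solve-∀)
  open import Relation.Binary.PropositionalEquality
  open import Algebra.Bundles using (CommutativeRing; CommutativeSemigroup)
  open import Relation.Binary.Bundles using (Setoid)
  open import Tactic.RingSolver.Core.AlmostCommutativeRing
    using (AlmostCommutativeRing; fromCommutativeRing)
  import Algebra.Consequences.Setoid as Consequences
  import Algebra.Properties.CommutativeSemigroup as CommutativeSemigroupProperties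
  import Data.Empty.Irrelevant as Irrelevant

  coeff : Poly → ℕ → ℤ
  coeff []      _       = + 0
  coeff (a ∷ p) zero    = a
  coeff (a ∷ p) (suc i) = coeff p i

  infix 4 _≋_
  record _≋_ (p q : Poly) : Set where
    constructor mk≋
    field coeff-≡ : ∀ i → coeff p i ≡ coeff q i
  open _≋_ public

  ≋-refl : ∀ {p} → p ≋ p
  ≋-refl = mk≋ λ _ → refl

  ≋-sym : ∀ {p q} → p ≋ q → q ≋ p
  ≋-sym p≋q = mk≋ λ i → sym (coeff-≡ p≋q i)

  ≋-trans : ∀ {p q r} → p ≋ q → q ≋ r → p ≋ r
  ≋-trans p≋q q≋r = mk≋ λ i → trans (coeff-≡ p≋q i) (coeff-≡ q≋r i)

  ≋-setoid : Setoid _ _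
  ≋-setoid = record
    { Carrier = Poly
    ; _≈_ = _≋_
    ; isEquivalence = record { refl = ≋-refl ; sym = ≋-sym ; trans = ≋-trans } }

  ∷-cong : ∀ {a b p q} → a ≡ b → p ≋ q → (a ∷ p) ≋ (b ∷ q)
  ∷-cong a≡b p≋q = mk≋ λ where
    zero    → a≡b
    (suc i) → coeff-≡ p≋q i

  ∷-tail : ∀ {a b p q} → (a ∷ p) ≋ (b ∷ q) → p ≋ q
  ∷-tail e = mk≋ λ i → coeff-≡ e (suc i)

  ∷-tail₀ : ∀ {a p} → (a ∷ p) ≋ [] → p ≋ []
  ∷-tail₀ e = mk≋ λ i → coeff-≡ e (suc i)

  ∷-≋[] : ∀ {a p} → a ≡ + 0 → p ≋ [] → (a ∷ p) ≋ []
  ∷-≋[] a≡0 e = mk≋ λ where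
    zero    → a≡0
    (suc i) → coeff-≡ e i

  coeff-+ₚ : ∀ p q i → coeff (p +ₚ q) i ≡ coeff p i +ℤ coeff q i
  coeff-+ₚ []      q       i       = sym (ℤP.+-identityˡ _)
  coeff-+ₚ (a ∷ p) []      i       = sym (ℤP.+-identityʳ _)
  coeff-+ₚ (a ∷ p) (b ∷ q) zero    = refl
  coeff-+ₚ (a ∷ p) (b ∷ q) (suc i) = coeff-+ₚ p q i

  coeff-·ₚ : ∀ a p i → coeff (a ·ₚ p) i ≡ a *ℤ coeff p i
  coeff-·ₚ a []      i       = sym (ℤP.*-zeroʳ a)
  coeff-·ₚ a (b ∷ p) zero    = refl
  coeff-·ₚ a (b ∷ p) (suc i) = coeff-·ₚ a p i

  coeff-negₚ : ∀ p i → coeff (negₚ p) i ≡ - coeff p i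
  coeff-negₚ []      i       = refl
  coeff-negₚ (b ∷ p) zero    = refl
  coeff-negₚ (b ∷ p) (suc i) = coeff-negₚ p i

  +ₚ-cong : ∀ {p p′ q q′} → p ≋ p′ → q ≋ q′ → p +ₚ q ≋ p′ +ₚ q′
  +ₚ-cong {p} {p′} {q} {q′} e f = mk≋ λ i → begin
    coeff (p +ₚ q) i          ≡⟨ coeff-+ₚ p q i ⟩
    coeff p i +ℤ coeff q i    ≡⟨ cong₂ _+ℤ_ (coeff-≡ e i) (coeff-≡ f i) ⟩
    coeff p′ i +ℤ coeff q′ i  ≡⟨ coeff-+ₚ p′ q′ i ⟨
    coeff (p′ +ₚ q′) i        ∎
    where open ≡-Reasoning

  negₚ-cong : ∀ {p q} → p ≋ q → negₚ p ≋ negₚ q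
  negₚ-cong {p} {q} e = mk≋ λ i →
    trans (coeff-negₚ p i) (trans (cong -_ (coeff-≡ e i)) (sym (coeff-negₚ q i)))

  ·ₚ-congʳ : ∀ a {p q} → p ≋ q → a ·ₚ p ≋ a ·ₚ q
  ·ₚ-congʳ a {p} {q} e = mk≋ λ i →
    trans (coeff-·ₚ a p i) (trans (cong (a *ℤ_) (coeff-≡ e i)) (sym (coeff-·ₚ a q i)))

  +ₚ-assoc : ∀ p q r → (p +ₚ q) +ₚ r ≋ p +ₚ (q +ₚ r)
  +ₚ-assoc p q r = mk≋ λ i → begin
    coeff ((p +ₚ q) +ₚ r) i                ≡⟨ coeff-+ₚ (p +ₚ q) r i ⟩
    coeff (p +ₚ q) i +ℤ coeff r i          ≡⟨ cong (_+ℤ coeff r i) (coeff-+ₚ p q i) ⟩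
    coeff p i +ℤ coeff q i +ℤ coeff r i    ≡⟨ ℤP.+-assoc (coeff p i) _ _ ⟩
    coeff p i +ℤ (coeff q i +ℤ coeff r i)  ≡⟨ cong (coeff p i +ℤ_) (coeff-+ₚ q r i) ⟨
    coeff p i +ℤ coeff (q +ₚ r) i          ≡⟨ coeff-+ₚ p (q +ₚ r) i ⟨
    coeff (p +ₚ (q +ₚ r)) i                ∎
    where open ≡-Reasoning

  +ₚ-comm : ∀ p q → p +ₚ q ≋ q +ₚ p
  +ₚ-comm p q = mk≋ λ i →
    trans (coeff-+ₚ p q i) (trans (ℤP.+-comm (coeff p i) _) (sym (coeff-+ₚ q p i)))

  +ₚ-identityˡ : ∀ p → [] +ₚ p ≋ p
  +ₚ-identityˡ p = ≋-refl

  +ₚ-identityʳ : ∀ p → p +ₚ [] ≋ p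
  +ₚ-identityʳ p = mk≋ λ i → trans (coeff-+ₚ p [] i) (ℤP.+-identityʳ _)

  +ₚ-inverseʳ : ∀ p → p +ₚ negₚ p ≋ []
  +ₚ-inverseʳ p = mk≋ λ i →
    trans (coeff-+ₚ p _ i) (trans (cong (coeff p i +ℤ_) (coeff-negₚ p i)) (ℤP.+-inverseʳ (coeff p i)))

  ·ₚ-distribʳ : ∀ a b p → (a +ℤ b) ·ₚ p ≋ (a ·ₚ p) +ₚ (b ·ₚ p)
  ·ₚ-distribʳ a b p = mk≋ λ i → begin
    coeff ((a +ℤ b) ·ₚ p) i               ≡⟨ coeff-·ₚ (a +ℤ b) p i ⟩
    (a +ℤ b) *ℤ coeff p i                 ≡⟨ ℤP.*-distribʳ-+ (coeff p i) a b ⟩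
    a *ℤ coeff p i +ℤ b *ℤ coeff p i      ≡⟨ cong₂ _+ℤ_ (coeff-·ₚ a p i) (coeff-·ₚ b p i) ⟨
    coeff (a ·ₚ p) i +ℤ coeff (b ·ₚ p) i  ≡⟨ coeff-+ₚ (a ·ₚ p) (b ·ₚ p) i ⟨
    coeff ((a ·ₚ p) +ₚ (b ·ₚ p)) i        ∎
    where open ≡-Reasoning

  ·ₚ-distribˡ : ∀ a p q → a ·ₚ (p +ₚ q) ≋ (a ·ₚ p) +ₚ (a ·ₚ q)
  ·ₚ-distribˡ a p q = mk≋ λ i → begin
    coeff (a ·ₚ (p +ₚ q)) i               ≡⟨ coeff-·ₚ a (p +ₚ q) i ⟩
    a *ℤ coeff (p +ₚ q) i                 ≡⟨ cong (a *ℤ_) (coeff-+ₚ p q i) ⟩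
    a *ℤ (coeff p i +ℤ coeff q i)         ≡⟨ ℤP.*-distribˡ-+ a (coeff p i) _ ⟩
    a *ℤ coeff p i +ℤ a *ℤ coeff q i      ≡⟨ cong₂ _+ℤ_ (coeff-·ₚ a p i) (coeff-·ₚ a q i) ⟨
    coeff (a ·ₚ p) i +ℤ coeff (a ·ₚ q) i  ≡⟨ coeff-+ₚ (a ·ₚ p) (a ·ₚ q) i ⟨
    coeff ((a ·ₚ p) +ₚ (a ·ₚ q)) i        ∎
    where open ≡-Reasoning

  ·ₚ-assoc : ∀ a b p → a ·ₚ (b ·ₚ p) ≋ (a *ℤ b) ·ₚ p
  ·ₚ-assoc a b p = mk≋ λ i → begin
    coeff (a ·ₚ (b ·ₚ p)) i  ≡⟨ coeff-·ₚ a (b ·ₚ p) i ⟩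
    a *ℤ coeff (b ·ₚ p) i    ≡⟨ cong (a *ℤ_) (coeff-·ₚ b p i) ⟩
    a *ℤ (b *ℤ coeff p i)    ≡⟨ ℤP.*-assoc a b _ ⟨
    a *ℤ b *ℤ coeff p i      ≡⟨ coeff-·ₚ (a *ℤ b) p i ⟨
    coeff ((a *ℤ b) ·ₚ p) i  ∎
    where open ≡-Reasoning

  0·ₚ : ∀ p → (+ 0) ·ₚ p ≋ []
  0·ₚ p = mk≋ (coeff-·ₚ (+ 0) p)

  1·ₚ : ∀ p → (+ 1) ·ₚ p ≋ p
  1·ₚ p = mk≋ λ i → trans (coeff-·ₚ (+ 1) p i) (ℤP.*-identityˡ (coeff p i))

  +ₚ-commutativeSemigroup : CommutativeSemigroup _ _
  +ₚ-commutativeSemigroup = record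
    { _≈_ = _≋_
    ; _∙_ = _+ₚ_
    ; isCommutativeSemigroup = record
      { isSemigroup = record
        { isMagma = record
          { isEquivalence = Setoid.isEquivalence ≋-setoid
          ; ∙-cong = +ₚ-cong }
        ; assoc = +ₚ-assoc }
      ; comm = +ₚ-comm } }

  open CommutativeSemigroupProperties +ₚ-commutativeSemigroup using (interchange; x∙yz≈y∙xz)

  *ₚ-zeroʳ : ∀ p → p *ₚ [] ≋ []
  *ₚ-zeroʳ []      = ≋-refl
  *ₚ-zeroʳ (a ∷ p) = ∷-≋[] refl (*ₚ-zeroʳ p)

  ≋[]⇒*ₚ≋[] : ∀ {p} q → p ≋ [] → p *ₚ q ≋ []
  ≋[]⇒*ₚ≋[] {[]}    q e = ≋-refl
  ≋[]⇒*ₚ≋[] {a ∷ p} q e rewrite coeff-≡ e 0 =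
    +ₚ-cong (0·ₚ q) (∷-≋[] refl (≋[]⇒*ₚ≋[] q (∷-tail₀ e)))

  *ₚ-congʳ : ∀ {p p′} q → p ≋ p′ → p *ₚ q ≋ p′ *ₚ q
  *ₚ-congʳ {[]}    {p′}     q e = ≋-sym (≋[]⇒*ₚ≋[] q (≋-sym e))
  *ₚ-congʳ {a ∷ p} {[]}     q e = ≋[]⇒*ₚ≋[] q e
  *ₚ-congʳ {a ∷ p} {b ∷ p′} q e rewrite coeff-≡ e 0 =
    +ₚ-cong ≋-refl (∷-cong refl (*ₚ-congʳ q (∷-tail e)))

  *ₚ-congˡ : ∀ p {q q′} → q ≋ q′ → p *ₚ q ≋ p *ₚ q′
  *ₚ-congˡ []      e = ≋-refl
  *ₚ-congˡ (a ∷ p) e = +ₚ-cong (·ₚ-congʳ a e) (∷-cong refl (*ₚ-congˡ p e))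

  *ₚ-cong : ∀ {p p′ q q′} → p ≋ p′ → q ≋ q′ → p *ₚ q ≋ p′ *ₚ q′
  *ₚ-cong {p′ = p′} {q} e f = ≋-trans (*ₚ-congʳ q e) (*ₚ-congˡ p′ f)

  *ₚ-distribʳ : ∀ r p q → (p +ₚ q) *ₚ r ≋ (p *ₚ r) +ₚ (q *ₚ r)
  *ₚ-distribʳ r []      q       = ≋-refl
  *ₚ-distribʳ r (a ∷ p) []      = ≋-sym (+ₚ-identityʳ _)
  *ₚ-distribʳ r (a ∷ p) (b ∷ q) =
    ≋-trans (+ₚ-cong (·ₚ-distribʳ a b r) (∷-cong refl (*ₚ-distribʳ r p q)))
            (interchange (a ·ₚ r) (b ·ₚ r) (+ 0 ∷ (p *ₚ r)) (+ 0 ∷ (q *ₚ r)))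

  ·ₚ-*ₚ : ∀ a p q → (a ·ₚ p) *ₚ q ≋ a ·ₚ (p *ₚ q)
  ·ₚ-*ₚ a []      q = ≋-refl
  ·ₚ-*ₚ a (b ∷ p) q = ≋-trans
    (+ₚ-cong (≋-sym (·ₚ-assoc a b q)) (∷-cong (sym (ℤP.*-zeroʳ a)) (·ₚ-*ₚ a p q)))
    (≋-sym (·ₚ-distribˡ a (b ·ₚ q) (+ 0 ∷ (p *ₚ q))))

  *ₚ-assoc : ∀ p q r → (p *ₚ q) *ₚ r ≋ p *ₚ (q *ₚ r)
  *ₚ-assoc []      q r = ≋-refl
  *ₚ-assoc (a ∷ p) q r = ≋-trans (*ₚ-distribʳ r (a ·ₚ q) (+ 0 ∷ (p *ₚ q)))
    (+ₚ-cong (·ₚ-*ₚ a q r)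
             (+ₚ-cong (0·ₚ r) (∷-cong refl (*ₚ-assoc p q r))))

  *ₚ-∷ʳ : ∀ p b q → p *ₚ (b ∷ q) ≋ (b ·ₚ p) +ₚ (+ 0 ∷ (p *ₚ q))
  *ₚ-∷ʳ []      b q = ≋-sym (∷-≋[] refl ≋-refl)
  *ₚ-∷ʳ (a ∷ p) b q = ∷-cong (cong (_+ℤ + 0) (ℤP.*-comm a b)) (begin
    (a ·ₚ q) +ₚ (p *ₚ (b ∷ q))                  ≈⟨ +ₚ-cong ≋-refl (*ₚ-∷ʳ p b q) ⟩
    (a ·ₚ q) +ₚ ((b ·ₚ p) +ₚ (+ 0 ∷ (p *ₚ q)))  ≈⟨ x∙yz≈y∙xz (a ·ₚ q) (b ·ₚ p) _ ⟩
    (b ·ₚ p) +ₚ ((a ·ₚ q) +ₚ (+ 0 ∷ (p *ₚ q)))  ∎)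
    where open import Relation.Binary.Reasoning.Setoid ≋-setoid

  *ₚ-comm : ∀ p q → p *ₚ q ≋ q *ₚ p
  *ₚ-comm []      q = ≋-sym (*ₚ-zeroʳ q)
  *ₚ-comm (a ∷ p) q = ≋-trans (+ₚ-cong ≋-refl (∷-cong refl (*ₚ-comm p q))) (≋-sym (*ₚ-∷ʳ q a p))

  1ₚ : Poly
  1ₚ = + 1 ∷ []

  *ₚ-identityˡ : ∀ p → 1ₚ *ₚ p ≋ p
  *ₚ-identityˡ p = ≋-trans (+ₚ-cong (1·ₚ p) (∷-≋[] refl ≋-refl)) (+ₚ-identityʳ p)

  ℤ[λ]-commutativeRing : CommutativeRing _ _
  ℤ[λ]-commutativeRing = record
    { Carrier = Poly
    ; _≈_ = _≋_
    ; _+_ = _+ₚ_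
    ; _*_ = _*ₚ_
    ; -_ = negₚ
    ; 0# = []
    ; 1# = 1ₚ
    ; isCommutativeRing = record
      { isRing = record
        { +-isAbelianGroup = record
          { isGroup = record
            { isMonoid = record
              { isSemigroup = CommutativeSemigroup.isSemigroup +ₚ-commutativeSemigroup
              ; identity = comm∧idˡ⇒id +ₚ-comm +ₚ-identityˡ }
            ; inverse = comm∧invʳ⇒inv +ₚ-comm +ₚ-inverseʳ
            ; ⁻¹-cong = negₚ-cong }
          ; comm = +ₚ-comm }
        ; *-cong = *ₚ-cong
        ; *-assoc = *ₚ-assoc
        ; *-identity = comm∧idˡ⇒id *ₚ-comm *ₚ-identityˡ
        ; distrib = comm∧distrʳ⇒distr +ₚ-cong *ₚ-comm *ₚ-distribʳ }
      ; *-comm = *ₚ-comm } }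
    where open Consequences ≋-setoid

  []≋? : ∀ p → Maybe ([] ≋ p)
  []≋? []      = just ≋-refl
  []≋? (a ∷ p) with a ℤP.≟ + 0 | []≋? p
  ... | yes a≡0 | just []≋p = just (≋-sym (∷-≋[] a≡0 (≋-sym []≋p)))
  ... | _       | _         = nothing

  ℤ[λ] : AlmostCommutativeRing _ _
  ℤ[λ] = fromCommutativeRing ℤ[λ]-commutativeRing []≋?

  NonZeroₚ : Poly → Set
  NonZeroₚ p = ¬ (p ≋ [])

  coeff₀-*ₚ : ∀ p r → coeff (p *ₚ r) 0 ≡ coeff p 0 *ℤ coeff r 0
  coeff₀-*ₚ []      r = refl
  coeff₀-*ₚ (a ∷ p) r = trans (coeff-+ₚ (a ·ₚ r) _ 0) (trans (ℤP.+-identityʳ _) (coeff-·ₚ a r 0))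

  coeff₀≢0⇒NonZeroₚ : ∀ {p} → coeff p 0 ≢ + 0 → NonZeroₚ p
  coeff₀≢0⇒NonZeroₚ c≢0 p≋0 = c≢0 (coeff-≡ p≋0 0)

  private
    *ₚ∷≋[]⇒≋[] : ∀ p {b} s → b ≢ + 0 → p *ₚ (b ∷ s) ≋ [] → p ≋ []
    *ₚ∷≋[]⇒≋[] []      s b≢0 e = ≋-refl
    *ₚ∷≋[]⇒≋[] (a ∷ p) {b} s b≢0 e = ∷-≋[] a≡0 (*ₚ∷≋[]⇒≋[] p s b≢0 p*bs≋0)
      where
      a≡0 : a ≡ + 0
      a≡0 with ℤP.i*j≡0⇒i≡0∨j≡0 a (trans (sym (ℤP.+-identityʳ (a *ℤ b))) (coeff-≡ e 0))
      ... | inj₁ a≡0 = a≡0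
      ... | inj₂ b≡0 = contradiction b≡0 b≢0
      p*bs≋0 : p *ₚ (b ∷ s) ≋ []
      p*bs≋0 = ≋-trans (+ₚ-cong (≋-sym (subst (λ c → c ·ₚ s ≋ []) (sym a≡0) (0·ₚ s))) ≋-refl)
                       (∷-tail₀ e)

  *ₚ≋[]⇒≋[] : ∀ p r → .(NonZeroₚ r) → p *ₚ r ≋ [] → p ≋ []
  *ₚ≋[]⇒≋[] p []      r≢0 e = Irrelevant.⊥-elim (r≢0 ≋-refl)
  *ₚ≋[]⇒≋[] p (b ∷ s) r≢0 e with b ℤP.≟ + 0
  ... | no b≢0   = *ₚ∷≋[]⇒≋[] p s b≢0 e
  ... | yes refl = *ₚ≋[]⇒≋[] p s (λ s≋0 → r≢0 (∷-≋[] refl s≋0))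
    (∷-tail₀ (≋-trans (≋-sym (≋-trans (*ₚ-∷ʳ p (+ 0) s) (+ₚ-cong (0·ₚ p) ≋-refl))) e))

  NonZeroₚ-*ₚ : ∀ {p r} → .(NonZeroₚ p) → .(NonZeroₚ r) → NonZeroₚ (p *ₚ r)
  NonZeroₚ-*ₚ {p} {r} p≢0 r≢0 pr≋0 = Irrelevant.⊥-elim (p≢0 (*ₚ≋[]⇒≋[] p r r≢0 pr≋0))

  *ₚ-cancelʳ : ∀ p q r → .(NonZeroₚ r) → p *ₚ r ≋ q *ₚ r → p ≋ q
  *ₚ-cancelʳ p q r r≢0 e = begin
    p                   ≈⟨ difference p q ⟩
    (p +ₚ negₚ q) +ₚ q  ≈⟨ +ₚ-cong (*ₚ≋[]⇒≋[] (p +ₚ negₚ q) r r≢0 [p-q]r≋0) ≋-refl ⟩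
    [] +ₚ q             ≡⟨⟩
    q                   ∎
    where
    open import Relation.Binary.Reasoning.Setoid ≋-setoid
    difference : ∀ p q → p ≋ (p +ₚ negₚ q) +ₚ q
    difference = solve-∀ ℤ[λ]
    distrib : ∀ p q r → (p +ₚ negₚ q) *ₚ r ≋ (p *ₚ r) +ₚ negₚ (q *ₚ r)
    distrib = solve-∀ ℤ[λ]
    [p-q]r≋0 : (p +ₚ negₚ q) *ₚ r ≋ []
    [p-q]r≋0 = ≋-trans (distrib p q r) (≋-trans (+ₚ-cong e ≋-refl) (+ₚ-inverseʳ (q *ₚ r)))

  ≋[]⇒IsZeroₚ : ∀ {p} → p ≋ [] → IsZeroₚ p
  ≋[]⇒IsZeroₚ {[]}    e = []
  ≋[]⇒IsZeroₚ {a ∷ p} e = coeff-≡ e 0 ∷ ≋[]⇒IsZeroₚ (∷-tail₀ e)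

  ≋⇒≈ₚ : ∀ {p q} → p ≋ q → p ≈ₚ q
  ≋⇒≈ₚ {p} {q} e = ≋[]⇒IsZeroₚ (≋-trans (+ₚ-cong e ≋-refl) (+ₚ-inverseʳ q))

module FractionField where

  open import Defs as D using (_+ₚ_; _*ₚ_; negₚ; RatFun; _/_; num; den)
  open Polynomial
  open import Data.Integer using (+_)
  open import Data.List using ([]; _∷_)
  open import Data.Maybe using (Maybe; just; nothing)
  open import Algebra.Bundles using (CommutativeRing)
  open import Relation.Binary.Bundles using (Setoid)
  open import Tactic.RingSolver using (solve-∀)
  open import Tactic.RingSolver.Core.AlmostCommutativeRing
    using (AlmostCommutativeRing; fromCommutativeRing)
  import Algebra.Consequences.Setoid as Consequences

  -- Without eta, x *ᶠ y stays neutral for neutral x and y, which keeps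
  -- unification against ring expressions working.
  record Frac : Set where
    no-eta-equality
    pattern
    constructor frac
    field
      val     : RatFun
      .den≢0  : NonZeroₚ (den val)
  open Frac public

  infix 4 _≃_
  record _≃_ (x y : Frac) : Set where
    constructor mk≃
    field cross : num (val x) *ₚ den (val y) ≋ num (val y) *ₚ den (val x)
  open _≃_ public

  1ₚ≢0 : NonZeroₚ 1ₚ
  1ₚ≢0 e with coeff-≡ e 0
  ... | ()

  infixl 6 _+ᶠ_
  infixl 7 _*ᶠ_

  _+ᶠ_ : Frac → Frac → Frac
  frac x x≢0 +ᶠ frac y y≢0 = frac (x D.+ y) (NonZeroₚ-*ₚ x≢0 y≢0)

  _*ᶠ_ : Frac → Frac → Frac
  frac x x≢0 *ᶠ frac y y≢0 = frac (x D.* y) (NonZeroₚ-*ₚ x≢0 y≢0)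

  -ᶠ_ : Frac → Frac
  -ᶠ frac x x≢0 = frac (D.neg x) x≢0

  0ᶠ 1ᶠ : Frac
  0ᶠ = frac D.𝟘 1ₚ≢0
  1ᶠ = frac D.𝟙 1ₚ≢0

  -- Every law is a polynomial identity between cross products; only
  -- transitivity needs more, namely cancellation of the middle denominator.

  ≃-refl : ∀ {x} → x ≃ x
  ≃-refl = mk≃ ≋-refl

  ≃-sym : ∀ {x y} → x ≃ y → y ≃ x
  ≃-sym (mk≃ e) = mk≃ (≋-sym e)

  ≃-trans : ∀ {x y z} → x ≃ y → y ≃ z → x ≃ z
  ≃-trans {frac (a / b) _} {frac (c / d) d≢0} {frac (e / f) _} (mk≃ ad≋cb) (mk≃ cf≋ed) =
    mk≃ (*ₚ-cancelʳ (a *ₚ f) (e *ₚ b) d d≢0 (begin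
      (a *ₚ f) *ₚ d  ≈⟨ swap a f d ⟩
      (a *ₚ d) *ₚ f  ≈⟨ *ₚ-congʳ f ad≋cb ⟩
      (c *ₚ b) *ₚ f  ≈⟨ swap c b f ⟩
      (c *ₚ f) *ₚ b  ≈⟨ *ₚ-congʳ b cf≋ed ⟩
      (e *ₚ d) *ₚ b  ≈⟨ swap e d b ⟩
      (e *ₚ b) *ₚ d  ∎))
    where
    open import Relation.Binary.Reasoning.Setoid ≋-setoid
    swap : ∀ u v w → (u *ₚ v) *ₚ w ≋ (u *ₚ w) *ₚ v
    swap = solve-∀ ℤ[λ]

  ≃-setoid : Setoid _ _
  ≃-setoid = record
    { Carrier = Frac
    ; _≈_ = _≃_
    ; isEquivalence = record
      { refl = λ {x} → ≃-refl {x} ; sym = λ {x} {y} → ≃-sym {x} {y} ; trans = λ {x} {y} {z} → ≃-trans {x} {y} {z} } }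

  +ᶠ-cong : ∀ {x x′ y y′} → x ≃ x′ → y ≃ y′ → x +ᶠ y ≃ x′ +ᶠ y′
  +ᶠ-cong {frac (a / b) _} {frac (a′ / b′) _} {frac (c / d) _} {frac (c′ / d′) _} (mk≃ e) (mk≃ f) =
    mk≃ (≋-trans (expand a b c d b′ d′)
          (≋-trans (+ₚ-cong (*ₚ-congʳ (d *ₚ d′) e) (*ₚ-congʳ (b *ₚ b′) f))
                   (collect a′ b′ c′ d′ b d)))
    where
    expand : ∀ a b c d b′ d′ →
      ((a *ₚ d) +ₚ (c *ₚ b)) *ₚ (b′ *ₚ d′) ≋ ((a *ₚ b′) *ₚ (d *ₚ d′)) +ₚ ((c *ₚ d′) *ₚ (b *ₚ b′))
    expand = solve-∀ ℤ[λ]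
    collect : ∀ a′ b′ c′ d′ b d →
      ((a′ *ₚ b) *ₚ (d *ₚ d′)) +ₚ ((c′ *ₚ d) *ₚ (b *ₚ b′)) ≋ ((a′ *ₚ d′) +ₚ (c′ *ₚ b′)) *ₚ (b *ₚ d)
    collect = solve-∀ ℤ[λ]

  *ᶠ-cong : ∀ {x x′ y y′} → x ≃ x′ → y ≃ y′ → x *ᶠ y ≃ x′ *ᶠ y′
  *ᶠ-cong {frac (a / b) _} {frac (a′ / b′) _} {frac (c / d) _} {frac (c′ / d′) _} (mk≃ e) (mk≃ f) =
    mk≃ (≋-trans (regroup a c b′ d′) (≋-trans (*ₚ-cong e f) (≋-sym (regroup a′ c′ b d))))
    where
    regroup : ∀ a c b′ d′ → (a *ₚ c) *ₚ (b′ *ₚ d′) ≋ (a *ₚ b′) *ₚ (c *ₚ d′)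
    regroup = solve-∀ ℤ[λ]

  -ᶠ-cong : ∀ {x x′} → x ≃ x′ → -ᶠ x ≃ -ᶠ x′
  -ᶠ-cong {frac (a / b) _} {frac (a′ / b′) _} (mk≃ e) =
    mk≃ (≋-trans (neg-*ₚ a b′) (≋-trans (negₚ-cong e) (≋-sym (neg-*ₚ a′ b))))
    where
    neg-*ₚ : ∀ a b → negₚ a *ₚ b ≋ negₚ (a *ₚ b)
    neg-*ₚ = solve-∀ ℤ[λ]

  +ᶠ-assoc : ∀ x y z → (x +ᶠ y) +ᶠ z ≃ x +ᶠ (y +ᶠ z)
  +ᶠ-assoc (frac (a / b) _) (frac (c / d) _) (frac (e / f) _) = mk≃ (law a b c d e f)
    where
    law : ∀ a b c d e f →
      ((((a *ₚ d) +ₚ (c *ₚ b)) *ₚ f) +ₚ (e *ₚ (b *ₚ d))) *ₚ (b *ₚ (d *ₚ f))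
        ≋ ((a *ₚ (d *ₚ f)) +ₚ (((c *ₚ f) +ₚ (e *ₚ d)) *ₚ b)) *ₚ ((b *ₚ d) *ₚ f)
    law = solve-∀ ℤ[λ]

  +ᶠ-comm : ∀ x y → x +ᶠ y ≃ y +ᶠ x
  +ᶠ-comm (frac (a / b) _) (frac (c / d) _) = mk≃ (law a b c d)
    where
    law : ∀ a b c d → ((a *ₚ d) +ₚ (c *ₚ b)) *ₚ (d *ₚ b) ≋ ((c *ₚ b) +ₚ (a *ₚ d)) *ₚ (b *ₚ d)
    law = solve-∀ ℤ[λ]

  +ᶠ-identityˡ : ∀ x → 0ᶠ +ᶠ x ≃ x
  +ᶠ-identityˡ (frac (a / b) _) = mk≃ (law a b)
    where
    law : ∀ a b → (((+ 0 ∷ []) *ₚ b) +ₚ (a *ₚ 1ₚ)) *ₚ b ≋ a *ₚ (1ₚ *ₚ b)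
    law = solve-∀ ℤ[λ]

  -ᶠ-inverseʳ : ∀ x → x +ᶠ (-ᶠ x) ≃ 0ᶠ
  -ᶠ-inverseʳ (frac (a / b) _) = mk≃ (law a b)
    where
    law : ∀ a b → ((a *ₚ b) +ₚ (negₚ a *ₚ b)) *ₚ 1ₚ ≋ (+ 0 ∷ []) *ₚ (b *ₚ b)
    law = solve-∀ ℤ[λ]

  *ᶠ-assoc : ∀ x y z → (x *ᶠ y) *ᶠ z ≃ x *ᶠ (y *ᶠ z)
  *ᶠ-assoc (frac (a / b) _) (frac (c / d) _) (frac (e / f) _) = mk≃ (law a b c d e f)
    where
    law : ∀ a b c d e f → ((a *ₚ c) *ₚ e) *ₚ (b *ₚ (d *ₚ f)) ≋ (a *ₚ (c *ₚ e)) *ₚ ((b *ₚ d) *ₚ f)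
    law = solve-∀ ℤ[λ]

  *ᶠ-comm : ∀ x y → x *ᶠ y ≃ y *ᶠ x
  *ᶠ-comm (frac (a / b) _) (frac (c / d) _) = mk≃ (law a b c d)
    where
    law : ∀ a b c d → (a *ₚ c) *ₚ (d *ₚ b) ≋ (c *ₚ a) *ₚ (b *ₚ d)
    law = solve-∀ ℤ[λ]

  *ᶠ-identityˡ : ∀ x → 1ᶠ *ᶠ x ≃ x
  *ᶠ-identityˡ (frac (a / b) _) = mk≃ (law a b)
    where
    law : ∀ a b → (1ₚ *ₚ a) *ₚ b ≋ a *ₚ (1ₚ *ₚ b)
    law = solve-∀ ℤ[λ]

  *ᶠ-distribʳ : ∀ x y z → (y +ᶠ z) *ᶠ x ≃ (y *ᶠ x) +ᶠ (z *ᶠ x)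
  *ᶠ-distribʳ (frac (a / b) _) (frac (c / d) _) (frac (e / f) _) = mk≃ (law a b c d e f)
    where
    law : ∀ a b c d e f →
      (((c *ₚ f) +ₚ (e *ₚ d)) *ₚ a) *ₚ ((d *ₚ b) *ₚ (f *ₚ b))
        ≋ (((c *ₚ a) *ₚ (f *ₚ b)) +ₚ ((e *ₚ a) *ₚ (d *ₚ b))) *ₚ ((d *ₚ f) *ₚ b)
    law = solve-∀ ℤ[λ]

  ℚ[λ]-commutativeRing : CommutativeRing _ _
  ℚ[λ]-commutativeRing = record
    { Carrier = Frac
    ; _≈_ = _≃_
    ; _+_ = _+ᶠ_
    ; _*_ = _*ᶠ_
    ; -_ = -ᶠ_
    ; 0# = 0ᶠ
    ; 1# = 1ᶠ
    ; isCommutativeRing = record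
      { isRing = record
        { +-isAbelianGroup = record
          { isGroup = record
            { isMonoid = record
              { isSemigroup = record
                { isMagma = record
                  { isEquivalence = Setoid.isEquivalence ≃-setoid
                  ; ∙-cong = λ {x} {x′} {y} {y′} → +ᶠ-cong {x} {x′} {y} {y′} }
                ; assoc = +ᶠ-assoc }
              ; identity = comm∧idˡ⇒id {_∙_ = _+ᶠ_} +ᶠ-comm {e = 0ᶠ} +ᶠ-identityˡ }
            ; inverse = comm∧invʳ⇒inv {_∙_ = _+ᶠ_} {_⁻¹ = -ᶠ_} {e = 0ᶠ} +ᶠ-comm -ᶠ-inverseʳ
            ; ⁻¹-cong = λ {x} {x′} → -ᶠ-cong {x} {x′} }
          ; comm = +ᶠ-comm }
        ; *-cong = λ {x} {x′} {y} {y′} → *ᶠ-cong {x} {x′} {y} {y′}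
        ; *-assoc = *ᶠ-assoc
        ; *-identity = comm∧idˡ⇒id {_∙_ = _*ᶠ_} *ᶠ-comm {e = 1ᶠ} *ᶠ-identityˡ
        ; distrib = comm∧distrʳ⇒distr {_∙_ = _*ᶠ_} {_◦_ = _+ᶠ_} (λ {x} {x′} {y} {y′} → +ᶠ-cong {x} {x′} {y} {y′}) *ᶠ-comm *ᶠ-distribʳ }
      ; *-comm = *ᶠ-comm } }
    where open Consequences ≃-setoid

  0ᶠ≃? : ∀ x → Maybe (0ᶠ ≃ x)
  0ᶠ≃? (frac (a / b) _) with []≋? a
  ... | just []≋a = just (mk≃ (≋-trans (law b) (*ₚ-congʳ 1ₚ []≋a)))
    where
    law : ∀ b → (+ 0 ∷ []) *ₚ b ≋ [] *ₚ 1ₚ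
    law = solve-∀ ℤ[λ]
  ... | nothing = nothing

  ℚ[λ] : AlmostCommutativeRing _ _
  ℚ[λ] = fromCommutativeRing ℚ[λ]-commutativeRing 0ᶠ≃?

  record NonZero (x : Frac) : Set where
    constructor mkNonZero
    field num≢0 : NonZeroₚ (num (val x))
  open NonZero public

  NonZero-* : ∀ {x y} → NonZero x → NonZero y → NonZero (x *ᶠ y)
  NonZero-* {frac _ _} {frac _ _} (mkNonZero x≢0) (mkNonZero y≢0) = mkNonZero (NonZeroₚ-*ₚ x≢0 y≢0)

  inv : (x : Frac) → .(NonZero x) → Frac
  inv (frac (a / b) _) x≢0 = frac (b / a) (num≢0 x≢0)

  *ᶠ-inverseʳ : ∀ x .(x≢0 : NonZero x) → x *ᶠ inv x x≢0 ≃ 1ᶠ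
  *ᶠ-inverseʳ (frac (a / b) _) _ = mk≃ (law a b)
    where
    law : ∀ a b → (a *ₚ b) *ₚ 1ₚ ≋ 1ₚ *ₚ (b *ₚ a)
    law = solve-∀ ℤ[λ]

  inv-* : ∀ x y .(xy≢0 : NonZero (x *ᶠ y)) .(x≢0 : NonZero x) .(y≢0 : NonZero y) →
          inv (x *ᶠ y) xy≢0 ≃ inv x x≢0 *ᶠ inv y y≢0
  inv-* (frac (_ / _) _) (frac (_ / _) _) _ _ _ = ≃-refl

  *ᶠ-cancelˡ : ∀ g .(g≢0 : NonZero g) {x y} → g *ᶠ x ≃ g *ᶠ y → x ≃ y
  *ᶠ-cancelˡ g g≢0 {x} {y} gx≃gy = begin
    x                ≈⟨ *ᶠ-identityˡ x ⟨
    1ᶠ *ᶠ x          ≈⟨ *-cong (*ᶠ-inverseʳ g g≢0) refl ⟨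
    (g *ᶠ g⁻¹) *ᶠ x  ≈⟨ regroup g⁻¹ g x ⟩
    g⁻¹ *ᶠ (g *ᶠ x)  ≈⟨ *-cong refl gx≃gy ⟩
    g⁻¹ *ᶠ (g *ᶠ y)  ≈⟨ regroup g⁻¹ g y ⟨
    (g *ᶠ g⁻¹) *ᶠ y  ≈⟨ *-cong (*ᶠ-inverseʳ g g≢0) refl ⟩
    1ᶠ *ᶠ y          ≈⟨ *ᶠ-identityˡ y ⟩
    y                ∎
    where
    open AlmostCommutativeRing ℚ[λ] using (setoid; *-cong; refl)
    open import Relation.Binary.Reasoning.Setoid setoid
    g⁻¹ : Frac
    g⁻¹ = inv g g≢0
    regroup : ∀ h g x → (g *ᶠ h) *ᶠ x ≃ h *ᶠ (g *ᶠ x)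
    regroup = solve-∀ ℚ[λ]

module Setup where

  open import Defs as D using (_+ₚ_; _*ₚ_; _/_; num; den)
  open Polynomial
  open FractionField
  open import Data.Nat as ℕ using (ℕ; zero; suc; _∸_)
  open import Data.Integer using (+_; -[1+_]) renaming (_+_ to _+ℤ_; _*_ to _*ℤ_)
  import Data.Integer.Properties as ℤP
  open import Data.List using ([]; _∷_)
  open import Relation.Binary.PropositionalEquality as ≡ using (_≡_; _≢_)
  open import Function using (case_of_)
  open import Algebra.Bundles using (CommutativeRing)
  open import Tactic.RingSolver.Core.AlmostCommutativeRing using (AlmostCommutativeRing)

  open AlmostCommutativeRing ℚ[λ] public hiding (_^_; _-_)
  open import Algebra.Properties.CommutativeSemiring.Exp
    (CommutativeRing.commutativeSemiring ℚ[λ]-commutativeRing) public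
    using (_^_; ^-homo-*; ^-assocʳ)

  infixl 6 _-_
  _-_ : Frac → Frac → Frac
  x - y = x + - y

  q : Frac
  q = frac D.λ̂ 1ₚ≢0

  prod : ℕ → (ℕ → Frac) → Frac
  prod zero    f = 1#
  prod (suc n) f = prod n f * f (suc n)

  fac : Frac → ℕ → Frac
  fac x n = prod n (λ i → x ^ i - 1#)

  poch : Frac → Frac → ℕ → Frac
  poch x y n = prod n (λ i → 1# - x * y ^ (i ∸ 1))

  -- the coefficient of the recurrence satisfied by both sides of the identity
  κ : ℕ → ℕ → Frac
  κ a b = (1# + q ^ (a ℕ.+ b)) * (q ^ suc (a ℕ.+ b) - 1#)

  -- Nonvanishing of the factors x^k ± 1 is read off from constant terms.
  record VanishesAt0 (x : Frac) : Set where
    field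
      num₀ : coeff (num (val x)) 0 ≡ + 0
      den₀ : coeff (den (val x)) 0 ≡ + 1
  open VanishesAt0

  q-vanishesAt0 : VanishesAt0 q
  q-vanishesAt0 = record { num₀ = ≡.refl ; den₀ = ≡.refl }

  VanishesAt0-* : ∀ {x y} → VanishesAt0 x → coeff (den (val y)) 0 ≡ + 1 → VanishesAt0 (x * y)
  VanishesAt0-* {frac (a / b) _} {frac (c / d) _} x₀ d₀ = record
    { num₀ = ≡.trans (coeff₀-*ₚ a c) (≡.cong (_*ℤ coeff c 0) (num₀ x₀))
    ; den₀ = ≡.trans (coeff₀-*ₚ b d) (≡.cong₂ _*ℤ_ (den₀ x₀) d₀) }

  VanishesAt0-^ : ∀ {x} → VanishesAt0 x → ∀ n → VanishesAt0 (x ^ suc n)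
  VanishesAt0-^ x₀ zero    = VanishesAt0-* x₀ ≡.refl
  VanishesAt0-^ x₀ (suc n) = VanishesAt0-* x₀ (den₀ (VanishesAt0-^ x₀ n))

  q²-vanishesAt0 : VanishesAt0 (q ^ 2)
  q²-vanishesAt0 = VanishesAt0-^ q-vanishesAt0 1

  VanishesAt0⇒+const≢0 : ∀ {x} → VanishesAt0 x → ∀ {c} → c ≢ + 0 → NonZero (x + frac (D.const c) 1ₚ≢0)
  VanishesAt0⇒+const≢0 {frac (a / b) _} x₀ {c} c≢0 =
    mkNonZero (coeff₀≢0⇒NonZeroₚ λ e → c≢0 (≡.trans (≡.sym constant-term) e))
    where
    constant-term : coeff ((a *ₚ (+ 1 ∷ [])) +ₚ ((c ∷ []) *ₚ b)) 0 ≡ c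
    constant-term = ≡.trans (coeff-+ₚ (a *ₚ (+ 1 ∷ [])) _ 0) (≡.trans (≡.cong₂ _+ℤ_
      (≡.trans (coeff₀-*ₚ a _) (≡.cong (_*ℤ + 1) (num₀ x₀)))
      (≡.trans (coeff₀-*ₚ (c ∷ []) b) (≡.cong (c *ℤ_) (den₀ x₀))))
      (≡.trans (ℤP.+-identityˡ _) (ℤP.*-identityʳ c)))

  1≢0 : NonZero 1#
  1≢0 = mkNonZero 1ₚ≢0

  q≢0 : NonZero q
  q≢0 = mkNonZero λ e → case coeff-≡ e 1 of λ ()

  NonZero-^ : ∀ {x} → NonZero x → ∀ n → NonZero (x ^ n)
  NonZero-^ x≢0 zero    = 1≢0
  NonZero-^ x≢0 (suc n) = NonZero-* x≢0 (NonZero-^ x≢0 n)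

  fac≢0 : ∀ {x} → VanishesAt0 x → ∀ n → NonZero (fac x n)
  fac≢0 x₀ zero    = 1≢0
  fac≢0 x₀ (suc n) = NonZero-* (fac≢0 x₀ n) (VanishesAt0⇒+const≢0 (VanishesAt0-^ x₀ n) { -[1+ 0 ] } λ ())

  ^+1≢0 : ∀ {x} → VanishesAt0 x → ∀ n → NonZero (x ^ n + 1#)
  ^+1≢0 x₀ zero    = mkNonZero λ e → case coeff-≡ e 0 of λ ()
  ^+1≢0 x₀ (suc n) = VanishesAt0⇒+const≢0 (VanishesAt0-^ x₀ n) {+ 1} λ ()

module DoubleSequences {c ℓ} (R : CommutativeRing c ℓ) where

  open CommutativeRing R
  open import Algebra.Properties.Ring ring using (x[y-z]≈xy-xz; [y-z]x≈yx-zx)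
  open import Algebra.Properties.AbelianGroup +-abelianGroup using (⁻¹-∙-comm)
  open import Algebra.Properties.CommutativeSemigroup +-commutativeSemigroup using (interchange)
  open import Algebra.Properties.CommutativeSemigroup *-commutativeSemigroup using (x∙yz≈y∙xz)
  open import Data.Nat using (ℕ; zero; suc; _∸_; _⊓_) renaming (_+_ to _+ℕ_)
  open import Function using (_∘_)
  open import Relation.Binary.PropositionalEquality as ≡ using (_≡_)
  open import Relation.Binary.Reasoning.Setoid setoid

  sumTo : ℕ → (ℕ → Carrier) → Carrier
  sumTo zero    f = f 0
  sumTo (suc n) f = sumTo n f + f (suc n)

  sumTo-peel : ∀ n f → sumTo (suc n) f ≈ f 0 + sumTo n (f ∘ suc)
  sumTo-peel zero    f = refl
  sumTo-peel (suc n) f = trans (+-cong (sumTo-peel n f) refl) (+-assoc (f 0) _ _)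

  diag : (ℕ → ℕ → ℕ → Carrier) → ℕ → ℕ → Carrier
  diag g zero    b       = g 0 0 b
  diag g (suc a) zero    = g 0 (suc a) 0
  diag g (suc a) (suc b) = g 0 (suc a) (suc b) + diag (g ∘ suc) a b

  diag-axis₂ : ∀ g a → diag g a 0 ≡ g 0 a 0
  diag-axis₂ g zero    = ≡.refl
  diag-axis₂ g (suc a) = ≡.refl

  sumTo-diag : ∀ g a b → sumTo (a ⊓ b) (λ c → g c (a ∸ c) (b ∸ c)) ≈ diag g a b
  sumTo-diag g zero    b       = refl
  sumTo-diag g (suc a) zero    = refl
  sumTo-diag g (suc a) (suc b) =
    trans (sumTo-peel (a ⊓ b) _) (+-cong refl (sumTo-diag (g ∘ suc) a b))

  diag-cong : ∀ {g g′} a b → (∀ c m n → c +ℕ m ≡ a → c +ℕ n ≡ b → g c m n ≈ g′ c m n) →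
              diag g a b ≈ diag g′ a b
  diag-cong zero    b       e = e 0 0 b ≡.refl ≡.refl
  diag-cong (suc a) zero    e = e 0 (suc a) 0 ≡.refl ≡.refl
  diag-cong (suc a) (suc b) e = +-cong (e 0 (suc a) (suc b) ≡.refl ≡.refl)
    (diag-cong a b λ c m n c+m≡a c+n≡b → e (suc c) m n (≡.cong suc c+m≡a) (≡.cong suc c+n≡b))

  diag-+ : ∀ g g′ a b → diag (λ c m n → g c m n + g′ c m n) a b ≈ diag g a b + diag g′ a b
  diag-+ g g′ zero    b       = refl
  diag-+ g g′ (suc a) zero    = refl
  diag-+ g g′ (suc a) (suc b) =
    trans (+-cong refl (diag-+ (g ∘ suc) (g′ ∘ suc) a b)) (interchange _ _ _ _)

  diag-* : ∀ k g a b → diag (λ c m n → k * g c m n) a b ≈ k * diag g a b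
  diag-* k g zero    b       = refl
  diag-* k g (suc a) zero    = refl
  diag-* k g (suc a) (suc b) =
    trans (+-cong refl (diag-* k (g ∘ suc) a b)) (sym (distribˡ k _ _))

  private
    diag-neg : ∀ g a b → diag (λ c m n → - g c m n) a b ≈ - diag g a b
    diag-neg g zero    b       = refl
    diag-neg g (suc a) zero    = refl
    diag-neg g (suc a) (suc b) = trans (+-cong refl (diag-neg (g ∘ suc) a b)) (⁻¹-∙-comm _ _)

  diag-− : ∀ g g′ a b → diag (λ c m n → g c m n - g′ c m n) a b ≈ diag g a b - diag g′ a b
  diag-− g g′ a b = trans (diag-+ g (λ c m n → - g′ c m n) a b) (+-cong refl (diag-neg g′ a b))

  infixl 7 _⋆_
  _⋆_ : (ℕ → Carrier) → (ℕ → ℕ → Carrier) → ℕ → ℕ → Carrier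
  f ⋆ h = diag (λ c m n → f c * h m n)

  -- shifts, reading a value at a negative index as 0
  shift : (ℕ → Carrier) → ℕ → Carrier
  shift f zero    = 0#
  shift f (suc c) = f c

  shift₁ shift₂ shift₁₂ : (ℕ → ℕ → Carrier) → ℕ → ℕ → Carrier
  shift₁ h zero    n = 0#
  shift₁ h (suc m) n = h m n
  shift₂ h m zero    = 0#
  shift₂ h m (suc n) = h m n
  shift₁₂ h (suc m) (suc n) = h m n
  shift₁₂ h _       _       = 0#

  private
    x+y*0≈x : ∀ x y → x + y * 0# ≈ x
    x+y*0≈x x y = trans (+-cong refl (zeroʳ y)) (+-identityʳ x)

  ⋆-shift₁ : ∀ f h a b → (f ⋆ shift₁ h) (suc a) b ≈ (f ⋆ h) a b
  ⋆-shift₁ f h zero    zero    = refl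
  ⋆-shift₁ f h (suc a) zero    = refl
  ⋆-shift₁ f h zero    (suc b) = x+y*0≈x _ (f 1)
  ⋆-shift₁ f h (suc a) (suc b) = +-cong refl (⋆-shift₁ (f ∘ suc) h a b)

  ⋆-shift₂ : ∀ f h a b → (f ⋆ shift₂ h) a (suc b) ≈ (f ⋆ h) a b
  ⋆-shift₂ f h zero          b       = refl
  ⋆-shift₂ f h 1             zero    = x+y*0≈x _ (f 1)
  ⋆-shift₂ f h (suc (suc a)) zero    = x+y*0≈x _ (f 1)
  ⋆-shift₂ f h (suc a)       (suc b) = +-cong refl (⋆-shift₂ (f ∘ suc) h a b)

  ⋆-shift₁₂ : ∀ f h a b → (f ⋆ shift₁₂ h) (suc a) (suc b) ≈ (f ⋆ h) a b
  ⋆-shift₁₂ f h zero    b       = x+y*0≈x _ (f 1)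
  ⋆-shift₁₂ f h (suc a) zero    = x+y*0≈x _ (f 1)
  ⋆-shift₁₂ f h (suc a) (suc b) = +-cong refl (⋆-shift₁₂ (f ∘ suc) h a b)

  shift-⋆ : ∀ f h a b → (shift f ⋆ h) (suc a) (suc b) ≈ (f ⋆ h) a b
  shift-⋆ f h a b = trans (+-cong (zeroˡ _) refl) (+-identityˡ _)

  shift₁₂-− : ∀ h k m n → shift₁₂ (λ i j → h i j - k i j) m n ≈ shift₁₂ h m n - shift₁₂ k m n
  shift₁₂-− h k (suc m) (suc n) = refl
  shift₁₂-− h k zero    n       = sym (-‿inverseʳ 0#)
  shift₁₂-− h k (suc m) zero    = sym (-‿inverseʳ 0#)

  ⋆-congˡ : ∀ {f f′} h a b → (∀ c → f c ≈ f′ c) → (f ⋆ h) a b ≈ (f′ ⋆ h) a b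
  ⋆-congˡ h a b e = diag-cong a b λ c m n _ _ → *-cong (e c) refl

  ⋆-congʳ : ∀ f {h h′} a b → (∀ m n → h m n ≈ h′ m n) → (f ⋆ h) a b ≈ (f ⋆ h′) a b
  ⋆-congʳ f a b e = diag-cong a b λ c m n _ _ → *-cong refl (e m n)

  ⋆-distribˡ-+ : ∀ f h k a b → (f ⋆ (λ m n → h m n + k m n)) a b ≈ (f ⋆ h) a b + (f ⋆ k) a b
  ⋆-distribˡ-+ f h k a b =
    trans (diag-cong a b λ c m n _ _ → distribˡ (f c) (h m n) (k m n)) (diag-+ _ _ a b)

  ⋆-distribˡ-− : ∀ f h k a b → (f ⋆ (λ m n → h m n - k m n)) a b ≈ (f ⋆ h) a b - (f ⋆ k) a b
  ⋆-distribˡ-− f h k a b =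
    trans (diag-cong a b λ c m n _ _ → x[y-z]≈xy-xz (f c) (h m n) (k m n)) (diag-− _ _ a b)

  ⋆-distribʳ-− : ∀ f g h a b → ((λ c → f c - g c) ⋆ h) a b ≈ (f ⋆ h) a b - (g ⋆ h) a b
  ⋆-distribʳ-− f g h a b =
    trans (diag-cong a b λ c m n _ _ → [y-z]x≈yx-zx (h m n) (f c) (g c)) (diag-− _ _ a b)

  ⋆-*ˡ : ∀ k f h a b → ((λ c → k * f c) ⋆ h) a b ≈ k * (f ⋆ h) a b
  ⋆-*ˡ k f h a b = trans (diag-cong a b λ c m n _ _ → *-assoc k (f c) (h m n)) (diag-* k _ a b)

  ⋆-*ʳ : ∀ k f h a b → (f ⋆ (λ m n → k * h m n)) a b ≈ k * (f ⋆ h) a b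
  ⋆-*ʳ k f h a b = trans (diag-cong a b λ c m n _ _ → x∙yz≈y∙xz (f c) k (h m n)) (diag-* k _ a b)

  ⋆-diagonal-difference : ∀ f h a b →
    (f ⋆ h) (suc a) (suc b) - (f ⋆ h) a b ≈ (f ⋆ (λ m n → h m n - shift₁₂ h m n)) (suc a) (suc b)
  ⋆-diagonal-difference f h a b = begin
    (f ⋆ h) (suc a) (suc b) - (f ⋆ h) a b                      ≈⟨ +-cong refl (-‿cong (⋆-shift₁₂ f h a b)) ⟨
    (f ⋆ h) (suc a) (suc b) - (f ⋆ shift₁₂ h) (suc a) (suc b)  ≈⟨ ⋆-distribˡ-− f h (shift₁₂ h) (suc a) (suc b) ⟨
    (f ⋆ (λ m n → h m n - shift₁₂ h m n)) (suc a) (suc b)      ∎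

  ⋆-move-shift : ∀ k f h a b →
    ((λ c → f c - k * shift f c) ⋆ h) (suc a) (suc b) ≈ (f ⋆ (λ m n → h m n - k * shift₁₂ h m n)) (suc a) (suc b)
  ⋆-move-shift k f h a b = begin
    ((λ c → f c - k * shift f c) ⋆ h) (suc a) (suc b)
      ≈⟨ ⋆-distribʳ-− f (λ c → k * shift f c) h (suc a) (suc b) ⟩
    (f ⋆ h) (suc a) (suc b) - ((λ c → k * shift f c) ⋆ h) (suc a) (suc b)
      ≈⟨ +-cong refl (-‿cong (⋆-*ˡ k (shift f) h (suc a) (suc b))) ⟩
    (f ⋆ h) (suc a) (suc b) - k * (shift f ⋆ h) (suc a) (suc b)
      ≈⟨ +-cong refl (-‿cong (*-cong refl (trans (shift-⋆ f h a b) (sym (⋆-shift₁₂ f h a b))))) ⟩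
    (f ⋆ h) (suc a) (suc b) - k * (f ⋆ shift₁₂ h) (suc a) (suc b)
      ≈⟨ +-cong refl (-‿cong (⋆-*ʳ k f (shift₁₂ h) (suc a) (suc b))) ⟨
    (f ⋆ h) (suc a) (suc b) - (f ⋆ (λ m n → k * shift₁₂ h m n)) (suc a) (suc b)
      ≈⟨ ⋆-distribˡ-− f h _ (suc a) (suc b) ⟨
    (f ⋆ (λ m n → h m n - k * shift₁₂ h m n)) (suc a) (suc b) ∎

  ⋆-shifts : ∀ f h a b →
    (f ⋆ (λ m n → h m n + shift₁ h m n + shift₂ h m n + shift₁₂ h m n)) (suc a) (suc b)
      ≈ (f ⋆ h) (suc a) (suc b) + (f ⋆ h) a (suc b) + (f ⋆ h) (suc a) b + (f ⋆ h) a b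
  ⋆-shifts f h a b = begin
    (f ⋆ (λ m n → h m n + shift₁ h m n + shift₂ h m n + shift₁₂ h m n)) (suc a) (suc b)
      ≈⟨ ⋆-distribˡ-+ f _ (shift₁₂ h) (suc a) (suc b) ⟩
    (f ⋆ (λ m n → h m n + shift₁ h m n + shift₂ h m n)) (suc a) (suc b) + (f ⋆ shift₁₂ h) (suc a) (suc b)
      ≈⟨ +-cong (⋆-distribˡ-+ f _ (shift₂ h) (suc a) (suc b)) (⋆-shift₁₂ f h a b) ⟩
    (f ⋆ (λ m n → h m n + shift₁ h m n)) (suc a) (suc b) + (f ⋆ shift₂ h) (suc a) (suc b) + (f ⋆ h) a b
      ≈⟨ +-cong (+-cong (⋆-distribˡ-+ f h (shift₁ h) (suc a) (suc b)) (⋆-shift₂ f h (suc a) b)) refl ⟩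
    (f ⋆ h) (suc a) (suc b) + (f ⋆ shift₁ h) (suc a) (suc b) + (f ⋆ h) (suc a) b + (f ⋆ h) a b
      ≈⟨ +-cong (+-cong (+-cong refl (⋆-shift₁ f h a (suc b))) refl) refl ⟩
    (f ⋆ h) (suc a) (suc b) + (f ⋆ h) a (suc b) + (f ⋆ h) (suc a) b + (f ⋆ h) a b ∎

  module _ (κ : ℕ → ℕ → Carrier) where

    Recurrence : (ℕ → ℕ → Carrier) → Set ℓ
    Recurrence f = ∀ a b → f (suc a) (suc b) ≈ f a (suc b) + f (suc a) b + κ a b * f a b

    recurrence-unique : ∀ {f g} → Recurrence f → Recurrence g →
                        (∀ b → f 0 b ≈ g 0 b) → (∀ a → f a 0 ≈ g a 0) →
                        ∀ a b → f a b ≈ g a b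
    recurrence-unique rf rg axis₁ axis₂ zero    b       = axis₁ b
    recurrence-unique rf rg axis₁ axis₂ (suc a) zero    = axis₂ (suc a)
    recurrence-unique {f} {g} rf rg axis₁ axis₂ (suc a) (suc b) = begin
      f (suc a) (suc b)
        ≈⟨ rf a b ⟩
      f a (suc b) + f (suc a) b + κ a b * f a b
        ≈⟨ +-cong (+-cong (ih a (suc b)) (ih (suc a) b)) (*-cong refl (ih a b)) ⟩
      g a (suc b) + g (suc a) b + κ a b * g a b
        ≈⟨ rg a b ⟨
      g (suc a) (suc b) ∎
      where
      ih : ∀ a b → f a b ≈ g a b
      ih = recurrence-unique rf rg axis₁ axis₂

module LeftSide where

  open Setup
  open FractionField using (Frac; NonZero; NonZero-*; inv; *ᶠ-inverseʳ; *ᶠ-cancelˡ; ℚ[λ]; ℚ[λ]-commutativeRing)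
  open DoubleSequences ℚ[λ]-commutativeRing
  open import Data.Nat as ℕ using (ℕ; zero; suc)
  import Data.Nat.Properties as ℕ
  open import Algebra.Properties.CommutativeSemigroup ℕ.+-commutativeSemigroup using () renaming (interchange to ℕ+-interchange)
  open import Relation.Binary.PropositionalEquality as ≡ using (_≡_)
  open import Relation.Binary.Reasoning.Setoid setoid
  open import Tactic.RingSolver using (solve-∀)
  open import Algebra.Bundles using (CommutativeRing)
  open import Algebra.Properties.CommutativeSemigroup (CommutativeRing.*-commutativeSemigroup ℚ[λ]-commutativeRing)
    using (x∙yz≈y∙xz)

  [_]! : ℕ → Frac
  [ n ]! = fac q n

  [_]!≢0 : ∀ n → NonZero [ n ]!
  [ n ]!≢0 = fac≢0 q-vanishesAt0 n

  [_]!⁻¹ : ℕ → Frac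
  [ n ]!⁻¹ = inv [ n ]! [ n ]!≢0

  []!-inverseʳ : ∀ n → [ n ]! * [ n ]!⁻¹ ≈ 1#
  []!-inverseʳ n = *ᶠ-inverseʳ [ n ]! [ n ]!≢0

  B : ℕ → ℕ → Frac
  B m n = q ^ (m ℕ.* n) * ([ m ]!⁻¹ * [ n ]!⁻¹)

  []!*[]!*B : ∀ m n → ([ m ]! * [ n ]!) * B m n ≈ q ^ (m ℕ.* n)
  []!*[]!*B m n = begin
    ([ m ]! * [ n ]!) * B m n
      ≈⟨ regroup [ m ]! [ n ]! _ [ m ]!⁻¹ [ n ]!⁻¹ ⟩
    q ^ (m ℕ.* n) * (([ m ]! * [ m ]!⁻¹) * ([ n ]! * [ n ]!⁻¹))
      ≈⟨ *-cong refl (*-cong ([]!-inverseʳ m) ([]!-inverseʳ n)) ⟩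
    q ^ (m ℕ.* n) * (1# * 1#)
      ≈⟨ unit _ ⟩
    q ^ (m ℕ.* n) ∎
    where
    regroup : ∀ a b p u v → (a * b) * (p * (u * v)) ≈ p * ((a * u) * (b * v))
    regroup = solve-∀ ℚ[λ]
    unit : ∀ p → p * (1# * 1#) ≈ p
    unit = solve-∀ ℚ[λ]

  private
    [m]![n]!≢0 : ∀ m n → NonZero ([ m ]! * [ n ]!)
    [m]![n]!≢0 m n = NonZero-* [ m ]!≢0 [ n ]!≢0

    trivial-shift : ∀ x b → x * 0# ≈ (1# - 1#) * b
    trivial-shift = solve-∀ ℚ[λ]

  shift₁-B : ∀ m n → q ^ n * shift₁ B m n ≈ (q ^ m - 1#) * B m n
  shift₁-B zero    n = trivial-shift (q ^ n) (B 0 n)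
  shift₁-B (suc m) n = *ᶠ-cancelˡ ([ m ]! * [ n ]!) ([m]![n]!≢0 m n) (begin
    ([ m ]! * [ n ]!) * (q ^ n * B m n)                   ≈⟨ x∙yz≈y∙xz _ (q ^ n) (B m n) ⟩
    q ^ n * (([ m ]! * [ n ]!) * B m n)                   ≈⟨ *-cong refl ([]!*[]!*B m n) ⟩
    q ^ n * q ^ (m ℕ.* n)                                 ≈⟨ ^-homo-* q n (m ℕ.* n) ⟨
    q ^ (suc m ℕ.* n)                                     ≈⟨ []!*[]!*B (suc m) n ⟨
    ([ suc m ]! * [ n ]!) * B (suc m) n                   ≈⟨ regroup [ m ]! (q ^ suc m - 1#) [ n ]! (B (suc m) n) ⟩
    ([ m ]! * [ n ]!) * ((q ^ suc m - 1#) * B (suc m) n)  ∎)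
    where
    regroup : ∀ f d g b → (f * d * g) * b ≈ (f * g) * (d * b)
    regroup = solve-∀ ℚ[λ]

  shift₂-B : ∀ m n → q ^ m * shift₂ B m n ≈ (q ^ n - 1#) * B m n
  shift₂-B m zero    = trivial-shift (q ^ m) (B m 0)
  shift₂-B m (suc n) = *ᶠ-cancelˡ ([ m ]! * [ n ]!) ([m]![n]!≢0 m n) (begin
    ([ m ]! * [ n ]!) * (q ^ m * B m n)                   ≈⟨ x∙yz≈y∙xz _ (q ^ m) (B m n) ⟩
    q ^ m * (([ m ]! * [ n ]!) * B m n)                   ≈⟨ *-cong refl ([]!*[]!*B m n) ⟩
    q ^ m * q ^ (m ℕ.* n)                                 ≈⟨ ^-homo-* q m (m ℕ.* n) ⟨
    q ^ (m ℕ.+ m ℕ.* n)                                   ≡⟨ ≡.cong (q ^_) (ℕ.*-suc m n) ⟨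
    q ^ (m ℕ.* suc n)                                     ≈⟨ []!*[]!*B m (suc n) ⟨
    ([ m ]! * [ suc n ]!) * B m (suc n)                   ≈⟨ regroup [ m ]! [ n ]! (q ^ suc n - 1#) (B m (suc n)) ⟩
    ([ m ]! * [ n ]!) * ((q ^ suc n - 1#) * B m (suc n))  ∎)
    where
    regroup : ∀ f g d b → (f * (g * d)) * b ≈ (f * g) * (d * b)
    regroup = solve-∀ ℚ[λ]

  shift₁₂-B : ∀ m n → q ^ m * q ^ n * shift₁₂ B m n ≈ q * ((q ^ m - 1#) * ((q ^ n - 1#) * B m n))
  shift₁₂-B zero    n       = trivial q (q ^ n) (q ^ n - 1#) (B 0 n)
    where
    trivial : ∀ q y z b → 1# * y * 0# ≈ q * ((1# - 1#) * (z * b))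
    trivial = solve-∀ ℚ[λ]
  shift₁₂-B (suc m) zero    = trivial q (q ^ suc m) (q ^ suc m - 1#) (B (suc m) 0)
    where
    trivial : ∀ q x z b → x * 1# * 0# ≈ q * (z * ((1# - 1#) * b))
    trivial = solve-∀ ℚ[λ]
  shift₁₂-B (suc m) (suc n) = begin
    q ^ suc m * q ^ suc n * B m n
      ≈⟨ regroup q (q ^ m) (q ^ suc n) (B m n) ⟩
    q * q ^ suc n * (q ^ m * B m n)
      ≈⟨ *-cong refl (shift₂-B m (suc n)) ⟩
    q * q ^ suc n * ((q ^ suc n - 1#) * B m (suc n))
      ≈⟨ regroup′ q (q ^ suc n) (q ^ suc n - 1#) (B m (suc n)) ⟩
    q * ((q ^ suc n - 1#) * (q ^ suc n * B m (suc n)))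
      ≈⟨ *-cong refl (*-cong refl (shift₁-B (suc m) (suc n))) ⟩
    q * ((q ^ suc n - 1#) * ((q ^ suc m - 1#) * B (suc m) (suc n)))
      ≈⟨ *-cong refl (x∙yz≈y∙xz _ _ _) ⟩
    q * ((q ^ suc m - 1#) * ((q ^ suc n - 1#) * B (suc m) (suc n))) ∎
    where
    regroup : ∀ q x y b → q * x * y * b ≈ q * y * (x * b)
    regroup = solve-∀ ℚ[λ]
    regroup′ : ∀ q y u b → q * y * (u * b) ≈ q * (u * (y * b))
    regroup′ = solve-∀ ℚ[λ]

  τB : ℕ → ℕ → Frac
  τB m n = q ^ (m ℕ.+ n) * B m n

  shift₁₂-τB : ∀ m n → q * q * shift₁₂ τB m n ≈ q ^ m * q ^ n * shift₁₂ B m n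
  shift₁₂-τB (suc m) (suc n) = begin
    q * q * (q ^ (m ℕ.+ n) * B m n)  ≈⟨ *-cong refl (*-cong (^-homo-* q m n) refl) ⟩
    q * q * (q ^ m * q ^ n * B m n)  ≈⟨ regroup q (q ^ m) (q ^ n) (B m n) ⟩
    q ^ suc m * q ^ suc n * B m n    ∎
    where
    regroup : ∀ q x y b → q * q * (x * y * b) ≈ q * x * (q * y) * b
    regroup = solve-∀ ℚ[λ]
  shift₁₂-τB zero    n       = trivial q (q ^ n)
    where
    trivial : ∀ q y → q * q * 0# ≈ 1# * y * 0#
    trivial = solve-∀ ℚ[λ]
  shift₁₂-τB (suc m) zero    = trivial q (q ^ suc m)
    where
    trivial : ∀ q x → q * q * 0# ≈ x * 1# * 0#
    trivial = solve-∀ ℚ[λ]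

  shift₁₂²-τB : ∀ m n → q * q * q * shift₁₂ (shift₁₂ τB) m n ≈ (q ^ m - q) * (q ^ n - q) * shift₁₂ B m n
  shift₁₂²-τB (suc m) (suc n) = begin
    q * q * q * shift₁₂ τB m n                         ≈⟨ regroup q (shift₁₂ τB m n) ⟩
    q * (q * q * shift₁₂ τB m n)                       ≈⟨ *-cong refl (shift₁₂-τB m n) ⟩
    q * (q ^ m * q ^ n * shift₁₂ B m n)                ≈⟨ *-cong refl (shift₁₂-B m n) ⟩
    q * (q * ((q ^ m - 1#) * ((q ^ n - 1#) * B m n)))  ≈⟨ factor q (q ^ m) (q ^ n) (B m n) ⟩
    (q * q ^ m - q) * (q * q ^ n - q) * B m n          ∎
    where
    regroup : ∀ q e → q * q * q * e ≈ q * (q * q * e)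
    regroup = solve-∀ ℚ[λ]
    factor : ∀ q x y b → q * (q * ((x - 1#) * ((y - 1#) * b))) ≈ (q * x - q) * (q * y - q) * b
    factor = solve-∀ ℚ[λ]
  shift₁₂²-τB zero    n       = trivial q (q ^ n - q)
    where
    trivial : ∀ q y → q * q * q * 0# ≈ (1# - q) * y * 0#
    trivial = solve-∀ ℚ[λ]
  shift₁₂²-τB (suc m) zero    = trivial q (q ^ suc m - q)
    where
    trivial : ∀ q x → q * q * q * 0# ≈ x * (1# - q) * 0#
    trivial = solve-∀ ℚ[λ]

  ΔτB : ℕ → ℕ → Frac
  ΔτB m n = τB m n - shift₁₂ τB m n

  -- After multiplying by q³ q^m q^n, the relations above turn every shifted value
  -- into a multiple of B m n, leaving a polynomial identity in q, q^m and q^n.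
  B-recurrence : ∀ m n → ΔτB m n - q * shift₁₂ ΔτB m n ≈ B m n + shift₁ B m n + shift₂ B m n + shift₁₂ B m n
  B-recurrence m n = begin
    ΔτB m n - q * shift₁₂ ΔτB m n  ≈⟨ +-cong refl (-‿cong (*-cong refl (shift₁₂-− τB (shift₁₂ τB) m n))) ⟩
    τB m n - E - q * (E - E₂)      ≈⟨ +-cong (+-cong (*-cong (^-homo-* q m n) refl) refl) refl ⟩
    X * Y * b - E - q * (E - E₂)   ≈⟨ *ᶠ-cancelˡ g g≢0 cleared ⟩
    b + s₁ + s₂ + D                ∎
    where
    X Y b E E₂ D s₁ s₂ g : Frac
    X = q ^ m
    Y = q ^ n
    b = B m n
    E = shift₁₂ τB m n
    E₂ = shift₁₂ (shift₁₂ τB) m n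
    D = shift₁₂ B m n
    s₁ = shift₁ B m n
    s₂ = shift₂ B m n
    g = q * q * q * (X * Y)
    g≢0 : NonZero g
    g≢0 = NonZero-* (NonZero-* {q * q} (NonZero-* {q} q≢0 q≢0) q≢0) (NonZero-* (NonZero-^ q≢0 m) (NonZero-^ q≢0 n))
    expand : ∀ q X Y b E E₂ →
      q * q * q * (X * Y) * (X * Y * b - E - q * (E - E₂))
        ≈ q * q * q * (X * Y) * (X * Y * b) - (1# + q) * (q * (X * Y)) * (q * q * E) + q * (X * Y) * (q * q * q * E₂)
    expand = solve-∀ ℚ[λ]
    collect : ∀ q X Y b D →
      q * q * q * (X * Y) * (X * Y * b) - (1# + q) * (q * (X * Y)) * (X * Y * D) + q * (X * Y) * ((X - q) * (Y - q) * D)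
        ≈ q * q * q * (X * Y) * (X * Y * b) + q * ((X - q) * (Y - q) - (1# + q) * (X * Y)) * (X * Y * D)
    collect = solve-∀ ℚ[λ]
    identity : ∀ q X Y b →
      q * q * q * (X * Y) * (X * Y * b) + q * ((X - q) * (Y - q) - (1# + q) * (X * Y)) * (q * ((X - 1#) * ((Y - 1#) * b)))
        ≈ q * q * q * (X * Y) * b + q * q * q * X * ((X - 1#) * b) + q * q * q * Y * ((Y - 1#) * b)
          + q * q * q * (q * ((X - 1#) * ((Y - 1#) * b)))
    identity = solve-∀ ℚ[λ]
    distribute : ∀ q X Y b s₁ s₂ D →
      q * q * q * (X * Y) * b + q * q * q * X * (Y * s₁) + q * q * q * Y * (X * s₂) + q * q * q * (X * Y * D)
        ≈ q * q * q * (X * Y) * (b + s₁ + s₂ + D)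
    distribute = solve-∀ ℚ[λ]
    cleared : g * (X * Y * b - E - q * (E - E₂)) ≈ g * (b + s₁ + s₂ + D)
    cleared = begin
      g * (X * Y * b - E - q * (E - E₂))
        ≈⟨ expand q X Y b E E₂ ⟩
      q * q * q * (X * Y) * (X * Y * b) - (1# + q) * (q * (X * Y)) * (q * q * E) + q * (X * Y) * (q * q * q * E₂)
        ≈⟨ +-cong (+-cong refl (-‿cong (*-cong refl (shift₁₂-τB m n)))) (*-cong refl (shift₁₂²-τB m n)) ⟩
      q * q * q * (X * Y) * (X * Y * b) - (1# + q) * (q * (X * Y)) * (X * Y * D) + q * (X * Y) * ((X - q) * (Y - q) * D)
        ≈⟨ collect q X Y b D ⟩
      q * q * q * (X * Y) * (X * Y * b) + q * ((X - q) * (Y - q) - (1# + q) * (X * Y)) * (X * Y * D)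
        ≈⟨ +-cong refl (*-cong refl (shift₁₂-B m n)) ⟩
      q * q * q * (X * Y) * (X * Y * b) + q * ((X - q) * (Y - q) - (1# + q) * (X * Y)) * (q * ((X - 1#) * ((Y - 1#) * b)))
        ≈⟨ identity q X Y b ⟩
      q * q * q * (X * Y) * b + q * q * q * X * ((X - 1#) * b) + q * q * q * Y * ((Y - 1#) * b)
        + q * q * q * (q * ((X - 1#) * ((Y - 1#) * b)))
        ≈⟨ +-cong (+-cong (+-cong refl (*-cong refl (shift₁-B m n))) (*-cong refl (shift₂-B m n))) (*-cong refl (shift₁₂-B m n)) ⟨
      q * q * q * (X * Y) * b + q * q * q * X * (Y * s₁) + q * q * q * Y * (X * s₂) + q * q * q * (X * Y * D)
        ≈⟨ distribute q X Y b s₁ s₂ D ⟩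
      g * (b + s₁ + s₂ + D) ∎

  A : ℕ → Frac
  A c = poch q (q ^ 2) c * q ^ c * [ c ℕ.+ c ]!⁻¹

  []!*A : ∀ c → [ c ℕ.+ c ]! * A c ≈ poch q (q ^ 2) c * q ^ c
  []!*A c = begin
    [ c ℕ.+ c ]! * (p * [ c ℕ.+ c ]!⁻¹)  ≈⟨ x∙yz≈y∙xz _ p _ ⟩
    p * ([ c ℕ.+ c ]! * [ c ℕ.+ c ]!⁻¹)  ≈⟨ *-cong refl ([]!-inverseʳ (c ℕ.+ c)) ⟩
    p * 1#                               ≈⟨ *-identityʳ p ⟩
    p                                    ∎
    where
    p : Frac
    p = poch q (q ^ 2) c * q ^ c

  τA : ℕ → Frac
  τA c = q ^ (c ℕ.+ c) * A c

  A-recurrence : ∀ c → τA c ≈ A c - q * shift A c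
  A-recurrence zero    = trivial q (A 0)
    where
    trivial : ∀ q a → 1# * a ≈ a - q * 0#
    trivial = solve-∀ ℚ[λ]
  A-recurrence (suc c) = *ᶠ-cancelˡ g ([ suc (suc k) ]!≢0) (begin
    g * (q ^ (suc c ℕ.+ suc c) * A (suc c))
      ≈⟨ x∙yz≈y∙xz g _ (A (suc c)) ⟩
    q ^ (suc c ℕ.+ suc c) * (g * A (suc c))
      ≈⟨ *-cong (reflexive (≡.cong (q ^_) 2c+2≡)) g*A[c+1] ⟩
    q * (q * T) * (P * (1# - q * (q ^ 2) ^ c) * (q * W))
      ≈⟨ *-cong refl (*-cong (*-cong refl (+-cong refl (-‿cong (*-cong refl q²ᶜ≈T)))) refl) ⟩
    q * (q * T) * (P * (1# - q * T) * (q * W))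
      ≈⟨ identity q T P W ⟩
    P * (1# - q * T) * (q * W) - q * (P * W * (q * T - 1#) * (q * (q * T) - 1#))
      ≈⟨ +-cong (*-cong (*-cong refl (+-cong refl (-‿cong (*-cong refl q²ᶜ≈T)))) refl) (-‿cong (*-cong refl g*A[c])) ⟨
    P * (1# - q * (q ^ 2) ^ c) * (q * W) - q * (g * A c)
      ≈⟨ +-cong g*A[c+1] refl ⟨
    g * A (suc c) - q * (g * A c)
      ≈⟨ distribute g (A (suc c)) (A c) q ⟨
    g * (A (suc c) - q * A c) ∎)
    where
    k : ℕ
    k = c ℕ.+ c
    g P T W : Frac
    g = [ suc (suc k) ]!
    P = poch q (q ^ 2) c
    T = q ^ k
    W = q ^ c
    2c+2≡ : suc c ℕ.+ suc c ≡ suc (suc k)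
    2c+2≡ = ≡.cong suc (ℕ.+-suc c c)
    q²ᶜ≈T : (q ^ 2) ^ c ≈ T
    q²ᶜ≈T = trans (^-assocʳ q 2 c) (reflexive (≡.cong (λ i → q ^ (c ℕ.+ i)) (ℕ.+-identityʳ c)))
    g*A[c+1] : g * A (suc c) ≈ poch q (q ^ 2) (suc c) * q ^ suc c
    g*A[c+1] = trans (*-cong (reflexive (≡.cong [_]! (≡.sym 2c+2≡))) refl) ([]!*A (suc c))
    regroup : ∀ f u v a → f * u * v * a ≈ f * a * u * v
    regroup = solve-∀ ℚ[λ]
    g*A[c] : g * A c ≈ P * W * (q * T - 1#) * (q * (q * T) - 1#)
    g*A[c] = trans (regroup [ k ]! (q * T - 1#) (q * (q * T) - 1#) (A c)) (*-cong (*-cong ([]!*A c) refl) refl)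
    identity : ∀ q T P W → q * (q * T) * (P * (1# - q * T) * (q * W))
                             ≈ P * (1# - q * T) * (q * W) - q * (P * W * (q * T - 1#) * (q * (q * T) - 1#))
    identity = solve-∀ ℚ[λ]
    distribute : ∀ g x y q → g * (x - q * y) ≈ g * x - q * (g * y)
    distribute = solve-∀ ℚ[λ]

  G : ℕ → ℕ → Frac
  G = A ⋆ B

  weighted-G : ∀ a b → q ^ (a ℕ.+ b) * G a b ≈ (τA ⋆ τB) a b
  weighted-G a b = trans (sym (diag-* (q ^ (a ℕ.+ b)) (λ c m n → A c * B m n) a b)) (diag-cong a b term)
    where
    regroup : ∀ x y a b → x * y * (a * b) ≈ x * a * (y * b)
    regroup = solve-∀ ℚ[λ]
    term : ∀ c m n → c ℕ.+ m ≡ a → c ℕ.+ n ≡ b → q ^ (a ℕ.+ b) * (A c * B m n) ≈ τA c * τB m n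
    term c m n ≡.refl ≡.refl = begin
      q ^ ((c ℕ.+ m) ℕ.+ (c ℕ.+ n)) * (A c * B m n)  ≡⟨ ≡.cong (λ i → q ^ i * (A c * B m n)) (ℕ+-interchange c m c n) ⟩
      q ^ ((c ℕ.+ c) ℕ.+ (m ℕ.+ n)) * (A c * B m n)  ≈⟨ *-cong (^-homo-* q (c ℕ.+ c) (m ℕ.+ n)) refl ⟩
      q ^ (c ℕ.+ c) * q ^ (m ℕ.+ n) * (A c * B m n)  ≈⟨ regroup _ _ (A c) (B m n) ⟩
      τA c * τB m n                                  ∎

  G-recurrence : ∀ a b → (q ^ (suc a ℕ.+ suc b) - 1#) * G (suc a) (suc b)
                         ≈ G a (suc b) + G (suc a) b + (1# + q ^ (a ℕ.+ b)) * G a b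
  G-recurrence a b = trans (rearrange (q ^ (suc a ℕ.+ suc b)) (q ^ (a ℕ.+ b)) _ _) (begin
    (q ^ (suc a ℕ.+ suc b) * G (suc a) (suc b) - q ^ (a ℕ.+ b) * G a b) - G (suc a) (suc b) + q ^ (a ℕ.+ b) * G a b
        ≈⟨ +-cong (+-cong (+-cong (weighted-G (suc a) (suc b)) (-‿cong (weighted-G a b))) refl) refl ⟩
    ((τA ⋆ τB) (suc a) (suc b) - (τA ⋆ τB) a b) - G (suc a) (suc b) + q ^ (a ℕ.+ b) * G a b
        ≈⟨ +-cong (+-cong weighted-difference refl) refl ⟩
    (G (suc a) (suc b) + G a (suc b) + G (suc a) b + G a b) - G (suc a) (suc b) + q ^ (a ℕ.+ b) * G a b
        ≈⟨ cancel _ _ _ _ _ ⟩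
    G a (suc b) + G (suc a) b + (1# + q ^ (a ℕ.+ b)) * G a b ∎)
    where
    rearrange : ∀ Z′ Z G′ G₀ → (Z′ - 1#) * G′ ≈ (Z′ * G′ - Z * G₀) - G′ + Z * G₀
    rearrange = solve-∀ ℚ[λ]
    cancel : ∀ G′ G₁ G₂ G₀ Z → (G′ + G₁ + G₂ + G₀) - G′ + Z * G₀ ≈ G₁ + G₂ + (1# + Z) * G₀
    cancel = solve-∀ ℚ[λ]
    weighted-difference : (τA ⋆ τB) (suc a) (suc b) - (τA ⋆ τB) a b
                          ≈ G (suc a) (suc b) + G a (suc b) + G (suc a) b + G a b
    weighted-difference = begin
      (τA ⋆ τB) (suc a) (suc b) - (τA ⋆ τB) a b
        ≈⟨ ⋆-diagonal-difference τA τB a b ⟩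
      (τA ⋆ ΔτB) (suc a) (suc b)
        ≈⟨ ⋆-congˡ ΔτB (suc a) (suc b) A-recurrence ⟩
      ((λ c → A c - q * shift A c) ⋆ ΔτB) (suc a) (suc b)
        ≈⟨ ⋆-move-shift q A ΔτB a b ⟩
      (A ⋆ (λ m n → ΔτB m n - q * shift₁₂ ΔτB m n)) (suc a) (suc b)
        ≈⟨ ⋆-congʳ A (suc a) (suc b) B-recurrence ⟩
      (A ⋆ (λ m n → B m n + shift₁ B m n + shift₂ B m n + shift₁₂ B m n)) (suc a) (suc b)
        ≈⟨ ⋆-shifts A B a b ⟩
      G (suc a) (suc b) + G a (suc b) + G (suc a) b + G a b ∎

  L : ℕ → ℕ → Frac
  L a b = [ a ℕ.+ b ]! * G a b

  L-recurrence : Recurrence κ L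
  L-recurrence a b = begin
    [ suc a ℕ.+ suc b ]! * G (suc a) (suc b)
      ≡⟨ ≡.cong (λ i → [ i ]! * G (suc a) (suc b)) 2+N≡ ⟩
    [ N ]! * f₁ * f₂ * G (suc a) (suc b)
      ≈⟨ *-assoc _ f₂ _ ⟩
    [ N ]! * f₁ * (f₂ * G (suc a) (suc b))
      ≈⟨ *-cong refl (trans (*-cong (reflexive (≡.cong (λ i → q ^ i - 1#) (≡.sym 2+N≡))) refl) (G-recurrence a b)) ⟩
    [ N ]! * f₁ * (G a (suc b) + G (suc a) b + (1# + q ^ N) * G a b)
      ≈⟨ distribute [ N ]! f₁ (G a (suc b)) (G (suc a) b) (G a b) (q ^ N) ⟩
    [ N ]! * f₁ * G a (suc b) + [ suc N ]! * G (suc a) b + κ a b * ([ N ]! * G a b)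
      ≡⟨ ≡.cong (λ i → [ i ]! * G a (suc b) + L (suc a) b + κ a b * L a b) (ℕ.+-suc a b) ⟨
    L a (suc b) + L (suc a) b + κ a b * L a b ∎
    where
    N : ℕ
    N = a ℕ.+ b
    f₁ f₂ : Frac
    f₁ = q ^ suc N - 1#
    f₂ = q ^ suc (suc N) - 1#
    2+N≡ : suc a ℕ.+ suc b ≡ suc (suc N)
    2+N≡ = ≡.cong suc (ℕ.+-suc a b)
    distribute : ∀ f u g₁ g₂ g₀ x → f * u * (g₁ + g₂ + (1# + x) * g₀) ≈ f * u * g₁ + f * u * g₂ + (1# + x) * u * (f * g₀)
    distribute = solve-∀ ℚ[λ]

  [0]!⁻¹≈1 : [ 0 ]!⁻¹ ≈ 1#
  [0]!⁻¹≈1 = trans (sym (*-identityˡ _)) ([]!-inverseʳ 0)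

  L-axis₁ : ∀ b → L 0 b ≈ 1#
  L-axis₁ b = begin
    [ b ]! * (1# * 1# * [ 0 ]!⁻¹ * (1# * ([ 0 ]!⁻¹ * [ b ]!⁻¹)))
      ≈⟨ regroup [ b ]! [ b ]!⁻¹ [ 0 ]!⁻¹ ⟩
    [ b ]! * [ b ]!⁻¹ * ([ 0 ]!⁻¹ * [ 0 ]!⁻¹)
      ≈⟨ *-cong ([]!-inverseʳ b) (*-cong [0]!⁻¹≈1 [0]!⁻¹≈1) ⟩
    1# * (1# * 1#)
      ≈⟨ unit ⟩
    1# ∎
    where
    regroup : ∀ f i j → f * (1# * 1# * j * (1# * (j * i))) ≈ f * i * (j * j)
    regroup = solve-∀ ℚ[λ]
    unit : 1# * (1# * 1#) ≈ 1#
    unit = solve-∀ ℚ[λ]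

  L-axis₂ : ∀ a → L a 0 ≈ 1#
  L-axis₂ a = begin
    [ a ℕ.+ 0 ]! * G a 0
      ≡⟨ ≡.cong₂ (λ i g → [ i ]! * g) (ℕ.+-identityʳ a) (diag-axis₂ _ a) ⟩
    [ a ]! * (A 0 * (q ^ (a ℕ.* 0) * ([ a ]!⁻¹ * [ 0 ]!⁻¹)))
      ≡⟨ ≡.cong (λ i → [ a ]! * (A 0 * (q ^ i * ([ a ]!⁻¹ * [ 0 ]!⁻¹)))) (ℕ.*-zeroʳ a) ⟩
    [ a ]! * (1# * 1# * [ 0 ]!⁻¹ * (1# * ([ a ]!⁻¹ * [ 0 ]!⁻¹)))
      ≈⟨ regroup [ a ]! [ a ]!⁻¹ [ 0 ]!⁻¹ ⟩
    [ a ]! * [ a ]!⁻¹ * ([ 0 ]!⁻¹ * [ 0 ]!⁻¹)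
      ≈⟨ *-cong ([]!-inverseʳ a) (*-cong [0]!⁻¹≈1 [0]!⁻¹≈1) ⟩
    1# * (1# * 1#)
      ≈⟨ unit ⟩
    1# ∎
    where
    regroup : ∀ f i j → f * (1# * 1# * j * (1# * (i * j))) ≈ f * i * (j * j)
    regroup = solve-∀ ℚ[λ]
    unit : 1# * (1# * 1#) ≈ 1#
    unit = solve-∀ ℚ[λ]

module RightSide where

  open Setup
  open FractionField using (Frac; NonZero; NonZero-*; inv; *ᶠ-inverseʳ; *ᶠ-cancelˡ; ℚ[λ]; ℚ[λ]-commutativeRing)
  open DoubleSequences ℚ[λ]-commutativeRing using (Recurrence)
  open import Data.Nat as ℕ using (ℕ; suc)
  import Data.Nat.Properties as ℕ
  open import Relation.Binary.PropositionalEquality as ≡ using (_≡_)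
  open import Relation.Binary.Reasoning.Setoid setoid
  open import Tactic.RingSolver using (solve-∀)

  [_]!₂ : ℕ → Frac
  [ n ]!₂ = fac (q ^ 2) n

  [_]!₂≢0 : ∀ n → NonZero [ n ]!₂
  [ n ]!₂≢0 = fac≢0 q²-vanishesAt0 n

  [_]!₂⁻¹ : ℕ → Frac
  [ n ]!₂⁻¹ = inv [ n ]!₂ [ n ]!₂≢0

  []!₂-inverseʳ : ∀ n → [ n ]!₂ * [ n ]!₂⁻¹ ≈ 1#
  []!₂-inverseʳ n = *ᶠ-inverseʳ [ n ]!₂ [ n ]!₂≢0

  h : ℕ → Frac
  h j = q ^ j + 1#

  h≢0 : ∀ j → NonZero (h j)
  h≢0 = ^+1≢0 q-vanishesAt0

  h⁻¹ : ℕ → Frac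
  h⁻¹ j = inv (h j) (h≢0 j)

  R : ℕ → ℕ → Frac
  R a b = [ a ℕ.+ b ]!₂ * ([ a ]!₂⁻¹ * [ b ]!₂⁻¹) * ((q ^ a + q ^ b) * h⁻¹ (a ℕ.+ b))

  R-cleared : ∀ a b → R a b * ([ a ]!₂ * [ b ]!₂ * h (a ℕ.+ b)) ≈ [ a ℕ.+ b ]!₂ * (q ^ a + q ^ b)
  R-cleared a b = begin
    R a b * ([ a ]!₂ * [ b ]!₂ * h (a ℕ.+ b))
      ≈⟨ regroup [ a ℕ.+ b ]!₂ [ a ]!₂⁻¹ [ b ]!₂⁻¹ (q ^ a + q ^ b) (h⁻¹ (a ℕ.+ b)) [ a ]!₂ [ b ]!₂ (h (a ℕ.+ b)) ⟩
    [ a ℕ.+ b ]!₂ * (q ^ a + q ^ b) * (([ a ]!₂ * [ a ]!₂⁻¹) * ([ b ]!₂ * [ b ]!₂⁻¹) * (h (a ℕ.+ b) * h⁻¹ (a ℕ.+ b)))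
      ≈⟨ *-cong refl (*-cong (*-cong ([]!₂-inverseʳ a) ([]!₂-inverseʳ b)) (*ᶠ-inverseʳ (h (a ℕ.+ b)) (h≢0 (a ℕ.+ b)))) ⟩
    [ a ℕ.+ b ]!₂ * (q ^ a + q ^ b) * (1# * 1# * 1#)
      ≈⟨ unit _ ⟩
    [ a ℕ.+ b ]!₂ * (q ^ a + q ^ b) ∎
    where
    regroup : ∀ f ia ib x i fa fb hh → f * (ia * ib) * (x * i) * (fa * fb * hh) ≈ f * x * ((fa * ia) * (fb * ib) * (hh * i))
    regroup = solve-∀ ℚ[λ]
    unit : ∀ y → y * (1# * 1# * 1#) ≈ y
    unit = solve-∀ ℚ[λ]

  q²^-square : ∀ j → (q ^ 2) ^ j ≈ q ^ j * q ^ j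
  q²^-square j = begin
    (q ^ 2) ^ j            ≈⟨ ^-assocʳ q 2 j ⟩
    q ^ (j ℕ.+ (j ℕ.+ 0))  ≡⟨ ≡.cong (λ i → q ^ (j ℕ.+ i)) (ℕ.+-identityʳ j) ⟩
    q ^ (j ℕ.+ j)          ≈⟨ ^-homo-* q j j ⟩
    q ^ j * q ^ j          ∎

  -- Clearing denominators in the recurrence at (a+1, b+1): with X = q^a, Y = q^b
  -- and Z = XY, each term times g is [a+b]!₂ times a polynomial in q, X and Y.

  module Cleared (a b : ℕ) where

    N : ℕ
    N = a ℕ.+ b
    X Y Z F u₁ u₂ v₁ v₂ h₀ h₁ h₂ : Frac
    X = q ^ a
    Y = q ^ b
    Z = X * Y
    F = [ N ]!₂
    u₁ = (q * Z) * (q * Z) - 1#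
    u₂ = (q * (q * Z)) * (q * (q * Z)) - 1#
    v₁ = (q * X) * (q * X) - 1#
    v₂ = (q * Y) * (q * Y) - 1#
    h₀ = Z + 1#
    h₁ = q * Z + 1#
    h₂ = q * (q * Z) + 1#

    g : Frac
    g = [ suc a ]!₂ * [ suc b ]!₂ * h (suc (suc N)) * (h (suc N) * h N)

    g≢0 : NonZero g
    g≢0 = NonZero-* (NonZero-* (NonZero-* [ suc a ]!₂≢0 [ suc b ]!₂≢0) (h≢0 (suc (suc N))))
                    (NonZero-* (h≢0 (suc N)) (h≢0 N))

    private
      q^N≈Z : q ^ N ≈ Z
      q^N≈Z = ^-homo-* q a b
      qZ : q * q ^ N ≈ q * Z
      qZ = *-cong refl q^N≈Z
      qqZ : q * (q * q ^ N) ≈ q * (q * Z)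
      qqZ = *-cong refl qZ
      [N+1]!₂ : [ suc N ]!₂ ≈ F * u₁
      [N+1]!₂ = *-cong refl (+-cong (trans (q²^-square (suc N)) (*-cong qZ qZ)) refl)
      [N+2]!₂ : [ suc (suc N) ]!₂ ≈ F * u₁ * u₂
      [N+2]!₂ = *-cong [N+1]!₂ (+-cong (trans (q²^-square (suc (suc N))) (*-cong qqZ qqZ)) refl)
      H₀ : h N ≈ h₀
      H₀ = +-cong q^N≈Z refl
      H₁ : h (suc N) ≈ h₁
      H₁ = +-cong qZ refl
      H₂ : h (suc (suc N)) ≈ h₂
      H₂ = +-cong qqZ refl
      V₁ : (q ^ 2) ^ suc a - 1# ≈ v₁
      V₁ = +-cong (q²^-square (suc a)) refl
      V₂ : (q ^ 2) ^ suc b - 1# ≈ v₂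
      V₂ = +-cong (q²^-square (suc b)) refl
      a+1+b+1≡ : suc a ℕ.+ suc b ≡ suc (suc N)
      a+1+b+1≡ = ≡.cong suc (ℕ.+-suc a b)
      a+b+1≡ : a ℕ.+ suc b ≡ suc N
      a+b+1≡ = ℕ.+-suc a b

    term₁ : g * R (suc a) (suc b) ≈ F * u₁ * u₂ * (q * X + q * Y) * (h₁ * h₀)
    term₁ = begin
      g * R (suc a) (suc b)
        ≈⟨ regroup [ suc a ]!₂ [ suc b ]!₂ (h (suc (suc N))) (h (suc N)) (h N) (R (suc a) (suc b)) ⟩
      R (suc a) (suc b) * ([ suc a ]!₂ * [ suc b ]!₂ * h (suc (suc N))) * (h (suc N) * h N)
        ≡⟨ ≡.cong (λ i → R (suc a) (suc b) * ([ suc a ]!₂ * [ suc b ]!₂ * h i) * (h (suc N) * h N)) a+1+b+1≡ ⟨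
      R (suc a) (suc b) * ([ suc a ]!₂ * [ suc b ]!₂ * h (suc a ℕ.+ suc b)) * (h (suc N) * h N)
        ≈⟨ *-cong (R-cleared (suc a) (suc b)) (*-cong H₁ H₀) ⟩
      [ suc a ℕ.+ suc b ]!₂ * (q * X + q * Y) * (h₁ * h₀)
        ≈⟨ *-cong (*-cong (trans (reflexive (≡.cong [_]!₂ a+1+b+1≡)) [N+2]!₂) refl) refl ⟩
      F * u₁ * u₂ * (q * X + q * Y) * (h₁ * h₀) ∎
      where
      regroup : ∀ fa fb h2 h1 h0 r → fa * fb * h2 * (h1 * h0) * r ≈ r * (fa * fb * h2) * (h1 * h0)
      regroup = solve-∀ ℚ[λ]

    term₂ : g * R a (suc b) ≈ F * u₁ * (X + q * Y) * (v₁ * (h₂ * h₀))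
    term₂ = begin
      g * R a (suc b)
        ≈⟨ regroup [ a ]!₂ ((q ^ 2) ^ suc a - 1#) [ suc b ]!₂ (h (suc (suc N))) (h (suc N)) (h N) (R a (suc b)) ⟩
      R a (suc b) * ([ a ]!₂ * [ suc b ]!₂ * h (suc N)) * (((q ^ 2) ^ suc a - 1#) * (h (suc (suc N)) * h N))
        ≡⟨ ≡.cong (λ i → R a (suc b) * ([ a ]!₂ * [ suc b ]!₂ * h i) * (((q ^ 2) ^ suc a - 1#) * (h (suc (suc N)) * h N))) a+b+1≡ ⟨
      R a (suc b) * ([ a ]!₂ * [ suc b ]!₂ * h (a ℕ.+ suc b)) * (((q ^ 2) ^ suc a - 1#) * (h (suc (suc N)) * h N))
        ≈⟨ *-cong (R-cleared a (suc b)) (*-cong V₁ (*-cong H₂ H₀)) ⟩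
      [ a ℕ.+ suc b ]!₂ * (X + q * Y) * (v₁ * (h₂ * h₀))
        ≈⟨ *-cong (*-cong (trans (reflexive (≡.cong [_]!₂ a+b+1≡)) [N+1]!₂) refl) refl ⟩
      F * u₁ * (X + q * Y) * (v₁ * (h₂ * h₀)) ∎
      where
      regroup : ∀ fa da fb h2 h1 h0 r → fa * da * fb * h2 * (h1 * h0) * r ≈ r * (fa * fb * h1) * (da * (h2 * h0))
      regroup = solve-∀ ℚ[λ]

    term₃ : g * R (suc a) b ≈ F * u₁ * (q * X + Y) * (v₂ * (h₂ * h₀))
    term₃ = begin
      g * R (suc a) b
        ≈⟨ regroup [ suc a ]!₂ [ b ]!₂ ((q ^ 2) ^ suc b - 1#) (h (suc (suc N))) (h (suc N)) (h N) (R (suc a) b) ⟩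
      R (suc a) b * ([ suc a ]!₂ * [ b ]!₂ * h (suc N)) * (((q ^ 2) ^ suc b - 1#) * (h (suc (suc N)) * h N))
        ≈⟨ *-cong (R-cleared (suc a) b) (*-cong V₂ (*-cong H₂ H₀)) ⟩
      [ suc N ]!₂ * (q * X + Y) * (v₂ * (h₂ * h₀))
        ≈⟨ *-cong (*-cong [N+1]!₂ refl) refl ⟩
      F * u₁ * (q * X + Y) * (v₂ * (h₂ * h₀)) ∎
      where
      regroup : ∀ fa fb db h2 h1 h0 r → fa * (fb * db) * h2 * (h1 * h0) * r ≈ r * (fa * fb * h1) * (db * (h2 * h0))
      regroup = solve-∀ ℚ[λ]

    term₄ : g * (κ a b * R a b) ≈ (1# + Z) * (q * Z - 1#) * (F * (X + Y)) * (v₁ * v₂ * (h₂ * h₁))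
    term₄ = begin
      g * (κ a b * R a b)
        ≈⟨ regroup [ a ]!₂ ((q ^ 2) ^ suc a - 1#) [ b ]!₂ ((q ^ 2) ^ suc b - 1#) (h (suc (suc N))) (h (suc N)) (h N) (κ a b) (R a b) ⟩
      κ a b * (R a b * ([ a ]!₂ * [ b ]!₂ * h N)) * (((q ^ 2) ^ suc a - 1#) * ((q ^ 2) ^ suc b - 1#) * (h (suc (suc N)) * h (suc N)))
        ≈⟨ *-cong (*-cong (*-cong (+-cong refl q^N≈Z) (+-cong qZ refl)) (R-cleared a b)) (*-cong (*-cong V₁ V₂) (*-cong H₂ H₁)) ⟩
      (1# + Z) * (q * Z - 1#) * (F * (X + Y)) * (v₁ * v₂ * (h₂ * h₁)) ∎
      where
      regroup : ∀ fa da fb db h2 h1 h0 k r →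
        fa * da * (fb * db) * h2 * (h1 * h0) * (k * r) ≈ k * (r * (fa * fb * h0)) * (da * db * (h2 * h1))
      regroup = solve-∀ ℚ[λ]

  R-recurrence : Recurrence κ R
  R-recurrence a b = *ᶠ-cancelˡ g g≢0 (begin
    g * R (suc a) (suc b)                      ≈⟨ term₁ ⟩
    F * u₁ * u₂ * (q * X + q * Y) * (h₁ * h₀)  ≈⟨ identity F q X Y ⟩
    F * u₁ * (X + q * Y) * (v₁ * (h₂ * h₀)) + F * u₁ * (q * X + Y) * (v₂ * (h₂ * h₀))
      + (1# + Z) * (q * Z - 1#) * (F * (X + Y)) * (v₁ * v₂ * (h₂ * h₁)) ≈⟨ +-cong (+-cong term₂ term₃) term₄ ⟨
    g * R a (suc b) + g * R (suc a) b + g * (κ a b * R a b)  ≈⟨ distribute g _ _ _ ⟩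
    g * (R a (suc b) + R (suc a) b + κ a b * R a b)          ∎)
    where
    open Cleared a b
    identity : ∀ F q X Y →
      let Z = X * Y in
      F * ((q * Z) * (q * Z) - 1#) * ((q * (q * Z)) * (q * (q * Z)) - 1#) * (q * X + q * Y) * ((q * Z + 1#) * (Z + 1#))
        ≈ F * ((q * Z) * (q * Z) - 1#) * (X + q * Y) * (((q * X) * (q * X) - 1#) * ((q * (q * Z) + 1#) * (Z + 1#)))
          + F * ((q * Z) * (q * Z) - 1#) * (q * X + Y) * (((q * Y) * (q * Y) - 1#) * ((q * (q * Z) + 1#) * (Z + 1#)))
          + (1# + Z) * (q * Z - 1#) * (F * (X + Y))
            * (((q * X) * (q * X) - 1#) * ((q * Y) * (q * Y) - 1#) * ((q * (q * Z) + 1#) * (q * Z + 1#)))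
    identity = solve-∀ ℚ[λ]
    distribute : ∀ g x y z → g * x + g * y + g * z ≈ g * (x + y + z)
    distribute = solve-∀ ℚ[λ]

  [0]!₂⁻¹≈1 : [ 0 ]!₂⁻¹ ≈ 1#
  [0]!₂⁻¹≈1 = trans (sym (*-identityˡ _)) ([]!₂-inverseʳ 0)

  private
    h-inverseʳ : ∀ j → h j * h⁻¹ j ≈ 1#
    h-inverseʳ j = *ᶠ-inverseʳ (h j) (h≢0 j)

  R-axis₁ : ∀ b → R 0 b ≈ 1#
  R-axis₁ b = begin
    [ b ]!₂ * ([ 0 ]!₂⁻¹ * [ b ]!₂⁻¹) * ((1# + q ^ b) * h⁻¹ b)
      ≈⟨ regroup [ b ]!₂ [ b ]!₂⁻¹ [ 0 ]!₂⁻¹ (q ^ b) (h⁻¹ b) ⟩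
    [ b ]!₂ * [ b ]!₂⁻¹ * [ 0 ]!₂⁻¹ * (h b * h⁻¹ b)
      ≈⟨ *-cong (*-cong ([]!₂-inverseʳ b) [0]!₂⁻¹≈1) (h-inverseʳ b) ⟩
    1# * 1# * 1#
      ≈⟨ unit ⟩
    1# ∎
    where
    regroup : ∀ f i j x i′ → f * (j * i) * ((1# + x) * i′) ≈ f * i * j * ((x + 1#) * i′)
    regroup = solve-∀ ℚ[λ]
    unit : 1# * 1# * 1# ≈ 1#
    unit = solve-∀ ℚ[λ]

  R-axis₂ : ∀ a → R a 0 ≈ 1#
  R-axis₂ a = begin
    [ a ℕ.+ 0 ]!₂ * ([ a ]!₂⁻¹ * [ 0 ]!₂⁻¹) * ((q ^ a + 1#) * h⁻¹ (a ℕ.+ 0))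
      ≡⟨ ≡.cong (λ i → [ i ]!₂ * ([ a ]!₂⁻¹ * [ 0 ]!₂⁻¹) * ((q ^ a + 1#) * h⁻¹ i)) (ℕ.+-identityʳ a) ⟩
    [ a ]!₂ * ([ a ]!₂⁻¹ * [ 0 ]!₂⁻¹) * (h a * h⁻¹ a)  ≈⟨ *-cong (*-assoc _ _ _) refl ⟨
    [ a ]!₂ * [ a ]!₂⁻¹ * [ 0 ]!₂⁻¹ * (h a * h⁻¹ a)    ≈⟨ *-cong (*-cong ([]!₂-inverseʳ a) [0]!₂⁻¹≈1) (h-inverseʳ a) ⟩
    1# * 1# * 1#                                       ≈⟨ unit ⟩
    1#                                                 ∎
    where
    unit : 1# * 1# * 1# ≈ 1#
    unit = solve-∀ ℚ[λ]

module Transfer where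

  open import Defs as D using (_/_)
  open Polynomial using (≋⇒≈ₚ)
  open FractionField
  open Setup
  open DoubleSequences ℚ[λ]-commutativeRing using (sumTo)
  open import Data.Nat as ℕ using (ℕ; zero; suc; _≟_; _≤?_; _∸_)
  import Data.Nat.Properties as ℕ
  open import Relation.Binary.PropositionalEquality as ≡ using (_≡_)
  open import Relation.Nullary using (yes; no; contradiction)

  -- The multinomials of Defs over Frac, with the same case splits so that val
  -- maps one onto the other.
  module _ (x : Frac) (x₀ : VanishesAt0 x) where

    private
      fac≢0′ : ∀ n → NonZero (fac x n)
      fac≢0′ = fac≢0 x₀

    multinom3ᶠ : ℕ → ℕ → ℕ → ℕ → Frac
    multinom3ᶠ n m₁ m₂ m₃ with n ≟ (m₁ ℕ.+ m₂ ℕ.+ m₃)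
    ... | yes _ = fac x n * inv (fac x m₁ * fac x m₂ * fac x m₃)
                                (NonZero-* (NonZero-* (fac≢0′ m₁) (fac≢0′ m₂)) (fac≢0′ m₃))
    ... | no  _ = 0#

    multinom2ᶠ : ℕ → ℕ → ℕ → Frac
    multinom2ᶠ n m₁ m₂ with n ≟ (m₁ ℕ.+ m₂)
    ... | yes _ = fac x n * inv (fac x m₁ * fac x m₂) (NonZero-* (fac≢0′ m₁) (fac≢0′ m₂))
    ... | no  _ = 0#

    binomᶠ : ℕ → ℕ → Frac
    binomᶠ n m with m ≤? n
    ... | yes _ = multinom2ᶠ n m (n ∸ m)
    ... | no  _ = 0#

    multinom3ᶠ-unfold : ∀ {n m₁ m₂ m₃} → n ≡ m₁ ℕ.+ m₂ ℕ.+ m₃ →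
      multinom3ᶠ n m₁ m₂ m₃ ≈ fac x n * (inv (fac x m₁) (fac≢0′ m₁) * inv (fac x m₂) (fac≢0′ m₂) * inv (fac x m₃) (fac≢0′ m₃))
    multinom3ᶠ-unfold {n} {m₁} {m₂} {m₃} e with n ≟ (m₁ ℕ.+ m₂ ℕ.+ m₃)
    ... | yes _ = *-cong refl (trans (inv-* (fac x m₁ * fac x m₂) (fac x m₃) f₁₂₃≢0 f₁₂≢0 (fac≢0′ m₃))
                                      (*-cong (inv-* (fac x m₁) (fac x m₂) f₁₂≢0 (fac≢0′ m₁) (fac≢0′ m₂)) refl))
      where
      f₁₂≢0 : NonZero (fac x m₁ * fac x m₂)
      f₁₂≢0 = NonZero-* (fac≢0′ m₁) (fac≢0′ m₂)
      f₁₂₃≢0 : NonZero (fac x m₁ * fac x m₂ * fac x m₃)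
      f₁₂₃≢0 = NonZero-* f₁₂≢0 (fac≢0′ m₃)
    ... | no  n≢ = contradiction e n≢

    binomᶠ-unfold : ∀ a b → binomᶠ (a ℕ.+ b) a ≈ fac x (a ℕ.+ b) * (inv (fac x a) (fac≢0′ a) * inv (fac x b) (fac≢0′ b))
    binomᶠ-unfold a b with a ≤? a ℕ.+ b
    ... | no  a≰ = contradiction (ℕ.m≤m+n a b) a≰
    ... | yes _ with a ℕ.+ b ≟ (a ℕ.+ ((a ℕ.+ b) ∸ a))
    ...   | no  n≢ = contradiction (≡.cong (a ℕ.+_) (≡.sym (ℕ.m+n∸m≡n a b))) n≢
    ...   | yes _ rewrite ℕ.m+n∸m≡n a b =
      *-cong refl (inv-* (fac x a) (fac x b) (NonZero-* (fac≢0′ a) (fac≢0′ b)) (fac≢0′ a) (fac≢0′ b))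

  val-+ : ∀ x y → val (x + y) ≡ val x D.+ val y
  val-+ (frac _ _) (frac _ _) = ≡.refl

  val-* : ∀ x y → val (x * y) ≡ val x D.* val y
  val-* (frac _ _) (frac _ _) = ≡.refl

  val-- : ∀ x y → val (x - y) ≡ val x D.- val y
  val-- (frac _ _) (frac _ _) = ≡.refl

  val-÷ : ∀ x y .(y≢0 : NonZero y) → val (x * inv y y≢0) ≡ val x D.÷ val y
  val-÷ (frac _ _) (frac (_ / _) _) _ = ≡.refl

  val-^ : ∀ x n → val (x ^ n) ≡ val x D.^ n
  val-^ x zero    = ≡.refl
  val-^ x (suc n) = ≡.trans (val-* x (x ^ n)) (≡.cong (val x D.*_) (val-^ x n))

  val-prod : ∀ n f g → (∀ i → val (f i) ≡ g i) → val (prod n f) ≡ D.prod n g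
  val-prod zero    f g e = ≡.refl
  val-prod (suc n) f g e = ≡.trans (val-* (prod n f) (f (suc n))) (≡.cong₂ D._*_ (val-prod n f g e) (e (suc n)))

  val-sumTo : ∀ n f g → (∀ i → val (f i) ≡ g i) → val (sumTo n f) ≡ D.sumTo n g
  val-sumTo zero    f g e = e 0
  val-sumTo (suc n) f g e = ≡.trans (val-+ (sumTo n f) (f (suc n))) (≡.cong₂ D._+_ (val-sumTo n f g e) (e (suc n)))

  val-fac : ∀ {x u} → val x ≡ u → ∀ n → val (fac x n) ≡ D.fac u n
  val-fac {x} ≡.refl n = val-prod n _ _ λ i → ≡.trans (val-- (x ^ i) 1#) (≡.cong (D._- D.𝟙) (val-^ x i))

  val-poch : ∀ {x y u v} → val x ≡ u → val y ≡ v → ∀ n → val (poch x y n) ≡ D.poch u v n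
  val-poch {x} {y} ≡.refl ≡.refl n = val-prod n _ _ λ i →
    ≡.trans (val-- 1# (x * y ^ (i ∸ 1))) (≡.cong (D.𝟙 D.-_)
      (≡.trans (val-* x (y ^ (i ∸ 1))) (≡.cong (val x D.*_) (val-^ y (i ∸ 1)))))

  val-multinom3 : ∀ {x u} x₀ → val x ≡ u → ∀ n m₁ m₂ m₃ → val (multinom3ᶠ x x₀ n m₁ m₂ m₃) ≡ D.multinom3 u n m₁ m₂ m₃
  val-multinom3 {x} x₀ e n m₁ m₂ m₃ with n ≟ (m₁ ℕ.+ m₂ ℕ.+ m₃)
  ... | yes _ = ≡.trans (val-÷ (fac x n) (fac x m₁ * fac x m₂ * fac x m₃) _) (≡.cong₂ D._÷_ (val-fac e n)
                 (≡.trans (val-* (fac x m₁ * fac x m₂) (fac x m₃)) (≡.cong₂ D._*_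
                   (≡.trans (val-* (fac x m₁) (fac x m₂)) (≡.cong₂ D._*_ (val-fac e m₁) (val-fac e m₂)))
                   (val-fac e m₃))))
  ... | no  _ = ≡.refl

  val-multinom2 : ∀ {x u} x₀ → val x ≡ u → ∀ n m₁ m₂ → val (multinom2ᶠ x x₀ n m₁ m₂) ≡ D.multinom2 u n m₁ m₂
  val-multinom2 {x} x₀ e n m₁ m₂ with n ≟ (m₁ ℕ.+ m₂)
  ... | yes _ = ≡.trans (val-÷ (fac x n) (fac x m₁ * fac x m₂) _) (≡.cong₂ D._÷_ (val-fac e n)
                 (≡.trans (val-* (fac x m₁) (fac x m₂)) (≡.cong₂ D._*_ (val-fac e m₁) (val-fac e m₂))))
  ... | no  _ = ≡.refl

  val-binom : ∀ {x u} x₀ → val x ≡ u → ∀ n m → val (binomᶠ x x₀ n m) ≡ D.binom u n m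
  val-binom x₀ e n m with m ≤? n
  ... | yes _ = val-multinom2 x₀ e n m (n ∸ m)
  ... | no  _ = ≡.refl

  ≃⇒≈ : ∀ {x y u v} → val x ≡ u → val y ≡ v → x ≈ y → u D.≈ v
  ≃⇒≈ ≡.refl ≡.refl x≈y = ≋⇒≈ₚ (cross x≈y)

module Identity where

  open import Data.Nat as N using (ℕ; _⊓_; _∸_)
  import Data.Nat.Properties as ℕ

  open FractionField using (Frac; val; ℚ[λ]; ℚ[λ]-commutativeRing)
  open Setup
  open DoubleSequences ℚ[λ]-commutativeRing using (sumTo; sumTo-diag; diag-cong; diag-*; recurrence-unique)
  open LeftSide
  open RightSide
  open Transfer
  import Defs as D
  open import Relation.Binary.PropositionalEquality as ≡ using (_≡_)
  open import Relation.Binary.Reasoning.Setoid setoid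
  open import Tactic.RingSolver using (solve-∀)
  import Data.Nat.Tactic.RingSolver as ℕ-Solver

  lhs : ℕ → ℕ → Frac
  lhs a b = sumTo (a ⊓ b) (λ c →
    poch q (q ^ 2) c * multinom3ᶠ q q-vanishesAt0 (a N.+ b) (2 N.* c) (a ∸ c) (b ∸ c) * q ^ ((a ∸ c) N.* (b ∸ c) N.+ c))

  rhs : ℕ → ℕ → Frac
  rhs a b = binomᶠ (q ^ 2) q²-vanishesAt0 (a N.+ b) a * ((q ^ a + q ^ b) * h⁻¹ (a N.+ b))

  lhs≈L : ∀ a b → lhs a b ≈ L a b
  lhs≈L a b = trans (sumTo-diag _ a b) (trans (diag-cong a b term) (diag-* [ a N.+ b ]! (λ c m n → A c * B m n) a b))
    where
    regroup : ∀ P F i₂ iₘ iₙ Q W → P * (F * (i₂ * iₘ * iₙ)) * (Q * W) ≈ F * (P * W * i₂ * (Q * (iₘ * iₙ)))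
    regroup = solve-∀ ℚ[λ]
    indices : ∀ c m n → (c N.+ m) N.+ (c N.+ n) ≡ 2 N.* c N.+ m N.+ n
    indices = ℕ-Solver.solve-∀
    term : ∀ c m n → c N.+ m ≡ a → c N.+ n ≡ b →
      poch q (q ^ 2) c * multinom3ᶠ q q-vanishesAt0 (a N.+ b) (2 N.* c) m n * q ^ (m N.* n N.+ c) ≈ [ a N.+ b ]! * (A c * B m n)
    term c m n ≡.refl ≡.refl = begin
      poch q (q ^ 2) c * multinom3ᶠ q q-vanishesAt0 (a N.+ b) (2 N.* c) m n * q ^ (m N.* n N.+ c)
        ≈⟨ *-cong (*-cong refl (multinom3ᶠ-unfold q q-vanishesAt0 (indices c m n))) (^-homo-* q (m N.* n) c) ⟩
      poch q (q ^ 2) c * ([ a N.+ b ]! * ([ 2 N.* c ]!⁻¹ * [ m ]!⁻¹ * [ n ]!⁻¹)) * (q ^ (m N.* n) * q ^ c)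
        ≡⟨ ≡.cong (λ i → poch q (q ^ 2) c * ([ a N.+ b ]! * ([ i ]!⁻¹ * [ m ]!⁻¹ * [ n ]!⁻¹)) * (q ^ (m N.* n) * q ^ c))
                  (≡.cong (c N.+_) (ℕ.+-identityʳ c)) ⟩
      poch q (q ^ 2) c * ([ a N.+ b ]! * ([ c N.+ c ]!⁻¹ * [ m ]!⁻¹ * [ n ]!⁻¹)) * (q ^ (m N.* n) * q ^ c)
        ≈⟨ regroup _ _ _ _ _ _ _ ⟩
      [ a N.+ b ]! * (A c * B m n) ∎

  rhs≈R : ∀ a b → rhs a b ≈ R a b
  rhs≈R a b = *-cong (binomᶠ-unfold (q ^ 2) q²-vanishesAt0 a b) refl

  lhs≈rhs : ∀ a b → lhs a b ≈ rhs a b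
  lhs≈rhs a b = begin
    lhs a b  ≈⟨ lhs≈L a b ⟩
    L a b    ≈⟨ recurrence-unique κ L-recurrence R-recurrence (λ b → trans (L-axis₁ b) (sym (R-axis₁ b)))
                                                              (λ a → trans (L-axis₂ a) (sym (R-axis₂ a))) a b ⟩
    R a b    ≈⟨ rhs≈R a b ⟨
    rhs a b  ∎

  val-lhs : ∀ a b → val (lhs a b) ≡ D.sumTo (a ⊓ b) (λ c →
    D.poch D.λ̂ (D.λ̂ D.^ 2) c D.* D.multinom3 D.λ̂ (a N.+ b) (2 N.* c) (a ∸ c) (b ∸ c) D.* (D.λ̂ D.^ ((a ∸ c) N.* (b ∸ c) N.+ c)))
  val-lhs a b = val-sumTo (a ⊓ b) _ _ λ c →
    ≡.trans (val-* (poch q (q ^ 2) c * multinom3ᶠ q q-vanishesAt0 (a N.+ b) (2 N.* c) (a ∸ c) (b ∸ c)) (q ^ ((a ∸ c) N.* (b ∸ c) N.+ c)))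
      (≡.cong₂ D._*_
        (≡.trans (val-* (poch q (q ^ 2) c) (multinom3ᶠ q q-vanishesAt0 (a N.+ b) (2 N.* c) (a ∸ c) (b ∸ c)))
          (≡.cong₂ D._*_ (val-poch ≡.refl (val-^ q 2) c) (val-multinom3 q-vanishesAt0 ≡.refl (a N.+ b) (2 N.* c) (a ∸ c) (b ∸ c))))
        (val-^ q ((a ∸ c) N.* (b ∸ c) N.+ c)))

  val-rhs : ∀ a b → val (rhs a b) ≡ D.binom (D.λ̂ D.^ 2) (a N.+ b) a D.* (((D.λ̂ D.^ a) D.+ (D.λ̂ D.^ b)) D.÷ ((D.λ̂ D.^ (a N.+ b)) D.+ D.𝟙))
  val-rhs a b =
    ≡.trans (val-* (binomᶠ (q ^ 2) q²-vanishesAt0 (a N.+ b) a) ((q ^ a + q ^ b) * h⁻¹ (a N.+ b))) (≡.cong₂ D._*_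
      (val-binom q²-vanishesAt0 (val-^ q 2) (a N.+ b) a)
      (≡.trans (val-÷ (q ^ a + q ^ b) (h (a N.+ b)) (h≢0 (a N.+ b))) (≡.cong₂ D._÷_
        (≡.trans (val-+ (q ^ a) (q ^ b)) (≡.cong₂ D._+_ (val-^ q a) (val-^ q b)))
        (≡.trans (val-+ (q ^ (a N.+ b)) 1#) (≡.cong (D._+ D.𝟙) (val-^ q (a N.+ b)))))))

open Identity using (val-lhs; val-rhs; lhs≈rhs)
open Transfer using (≃⇒≈)

open import Defs
open import Data.Nat using (ℕ; _⊓_; _∸_)
open import Data.Nat as N using ()

mainTheorem5 : (a b : ℕ) →
    sumTo (a ⊓ b) (λ c →
        poch λ̂ (λ̂ ^ 2) c
        * multinom3 λ̂ (a N.+ b) (2 N.* c) (a ∸ c) (b ∸ c)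
        * (λ̂ ^ ((a ∸ c) N.* (b ∸ c) N.+ c)))
      ≈ binom (λ̂ ^ 2) (a N.+ b) a
        * (((λ̂ ^ a) + (λ̂ ^ b)) ÷ ((λ̂ ^ (a N.+ b)) + 𝟙))
mainTheorem5 a b = ≃⇒≈ (val-lhs a b) (val-rhs a b) (lhs≈rhs a b)
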